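{- Let $n\ge3$, $W=W(D_n)$, $c=[1\ldots n-1][n]$ and $c=lr$ a bipartition of $c$. The dihedral group $\mathcal{D}=\langle\varphi_l,\varphi_r\rangle$ of lattice automorphisms of $\mathrm{NC}(W,c)$ has order $4(n-1)$ if $n$ is odd and order $2(n-1)$ if $n$ is even.
   Context: $W(D_n)$ is the group of signed permutations of $\{\pm1,\ldots,\pm n\}$ generated by $T=\{(\!(i\,j)\!):1\le i<|j|\le n\}$, where $(\!(i\,j)\!)=(i\,j)(-i\,-j)$ and $[i_1\ldots i_k]=(i_1\ldots i_k\,-i_1\ldots-i_k)$. $\ell$ is length with respect to $T$; absolute order $u\le w$ iff $\ell(w)=\ell(u)+\ell(u^{ -1}w)$; $\mathrm{NC}(W,c)=\{w:w\le c\}$. A bipartition is $c=lr$ with $l^2=r^2=\mathrm{id}$; $\varphi_l(w)=lw^{ -1}l$, $\varphi_r(w)=rw^{ -1}r$. -}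

module Defs where

open import Data.Nat using (ℕ; zero; suc; _+_; _*_; _∸_; _≤_; _<_; _<?_; _%_; _≡ᵇ_)
open import Data.Nat.Properties using (<-trans; n<1+n)
import Data.Nat.Properties as ℕP
open import Data.Fin using (Fin; toℕ; fromℕ<) renaming (zero to fz; suc to fs)
import Data.Fin.Properties as FinP
open import Data.Bool using (Bool; true; false; _xor_; if_then_else_)
open import Data.Vec using (Vec; lookup; tabulate)
open import Data.List using (List; []; _∷_; length; allFin)
open import Data.List.Relation.Unary.All using (All)
open import Data.Product using (Σ; ∃; ∃-syntax; _×_; _,_; proj₁; proj₂)
open import Relation.Nullary using (yes; no)
open import Relation.Nullary.Decidable using (⌊_⌋)
open import Relation.Binary.PropositionalEquality using (_≡_)

-- The letter i : Fin n stands for i+1; a signed letter is (i , s) with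
-- s = false meaning +(i+1) and s = true meaning -(i+1).
-- A signed permutation w is stored by its values on the positive letters:
-- lookup w i = (j , s) means w(+(i+1)) = s·(j+1) (and then w(-(i+1)) = -s·(j+1)).

SLetter : ℕ → Set
SLetter n = Fin n × Bool

SP : ℕ → Set
SP n = Vec (SLetter n) n

apply : ∀ {n} → SP n → SLetter n → SLetter n
apply w (j , s) = proj₁ (lookup w j) , (proj₂ (lookup w j) xor s)

_∙_ : ∀ {n} → SP n → SP n → SP n
u ∙ v = tabulate (λ i → apply u (lookup v i))

idSP : ∀ {n} → SP n
idSP = tabulate (λ i → i , false)

-- inverse: if w(+i) = s·j then w⁻¹(+j) = s·i
invAt : ∀ {n} → SP n → Fin n → List (Fin n) → SLetter n
invAt w j [] = j , false
invAt w j (i ∷ is) =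
  if ⌊ proj₁ (lookup w i) Data.Fin.≟ j ⌋ then (i , proj₂ (lookup w i)) else invAt w j is
  where import Data.Fin

inv : ∀ {n} → SP n → SP n
inv {n} w = tabulate (λ j → invAt w j (allFin n))

-- Reflections ((i j)) = (i j)(-i -j), 1 ≤ i < |j| ≤ n.
-- refl a b s (a < b) is ((a+1, s·(b+1))): a ↦ s·b, b ↦ s·a, others fixed.

reflSP : ∀ {n} → Fin n → Fin n → Bool → SP n
reflSP a b s = tabulate f
  where
  f : _ → _
  f k = if ⌊ k Data.Fin.≟ a ⌋ then (b , s)
        else (if ⌊ k Data.Fin.≟ b ⌋ then (a , s) else (k , false))
    where import Data.Fin

IsRefl : ∀ {n} → SP n → Set
IsRefl {n} t = ∃[ a ] ∃[ b ] ∃[ s ] (a Data.Fin.< b × t ≡ reflSP a b s)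
  where import Data.Fin

prod : ∀ {n} → List (SP n) → SP n
prod [] = idSP
prod (t ∷ ts) = t ∙ prod ts

TWord : ∀ {n} → SP n → ℕ → Set
TWord w k = ∃[ ts ] (All IsRefl ts × length ts ≡ k × prod ts ≡ w)

InW : ∀ {n} → SP n → Set
InW w = ∃[ k ] TWord w k

Len : ∀ {n} → SP n → ℕ → Set
Len w k = TWord w k × (∀ ts → All IsRefl ts → prod ts ≡ w → k ≤ length ts)

_≤T_ : ∀ {n} → SP n → SP n → Set
u ≤T w = ∃[ a ] ∃[ b ] (Len u a × Len (inv u ∙ w) b × Len w (a + b))

-- The Coxeter element c = [1 … n-1][n]:
--   i ↦ i+1 (1 ≤ i ≤ n-2),  n-1 ↦ -1,  n ↦ -n.

firstFin : ∀ {n} → Fin n → Fin n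
firstFin fz = fz
firstFin (fs _) = fz

cAt : ∀ {n} → Fin n → SLetter n
cAt {n} k with suc (suc (toℕ k)) <? n
... | yes p = fromℕ< (<-trans (n<1+n (suc (toℕ k))) p) , false
... | no _ with suc (toℕ k) ℕP.≟ n
...   | yes _ = k , true
...   | no _ = firstFin k , true

coxD : (n : ℕ) → SP n
coxD n = tabulate cAt

InNC : ∀ {n} → SP n → SP n → Set
InNC c w = w ≤T c

φ : ∀ {n} → SP n → SP n → SP n
φ x w = x ∙ (inv w ∙ x)

evalWord : ∀ {n} → SP n → SP n → List Bool → SP n → SP n
evalWord l r [] w = w
evalWord l r (true ∷ bs) w = φ l (evalWord l r bs w)
evalWord l r (false ∷ bs) w = φ r (evalWord l r bs w)

SameOnNC : ∀ {n} → SP n → SP n → SP n → List Bool → List Bool → Set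
SameOnNC c l r u v = ∀ w → InNC c w → evalWord l r u w ≡ evalWord l r v w

DihedralOrder : ∀ {n} → SP n → SP n → SP n → ℕ → Set
DihedralOrder c l r m =
  Σ (Fin m → List Bool) λ f →
    (∀ i j → SameOnNC c l r (f i) (f j) → i ≡ j) ×
    (∀ u → ∃[ i ] SameOnNC c l r u (f i))

expectedOrder : ℕ → ℕ
expectedOrder n = if (n % 2) ≡ᵇ 0 then 2 * (n ∸ 1) else 4 * (n ∸ 1)

module Submission where

-- Write h = n-1 when n is even and h = 2(n-1) when n is odd: h is the least
-- positive exponent for which c^h is central in W (c^(n-1) acts as -1 on the
-- first n-1 letters and as (-1)^(n-1) on the letter n).  Put
--   Rot j w = c^j w c^-j        and        Ref j w = l (Rot j w⁻¹) l.
-- Using l r = c and l² = r² = 1 one checks that φ_l swaps Rot j and Ref j,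
-- and φ_r sends Rot j to Ref (j+1) and Ref (j+1) to Rot j, indices read
-- modulo h.  Hence every word in φ_l, φ_r acts on W as one of the 2h maps
-- Rot j, Ref j (j < h), and each of them is realised by an explicit word.
-- These 2h maps are pairwise different already on the two reflections
-- t₀ = ((1 n)) and t₁ = c t₀ c⁻¹, both of which lie in NC(W,c).  Showing
-- t₀ ≤ c needs ℓ(c) = n: a product of fewer than n reflections fixes a
-- nonzero integer vector (solve the linear system it imposes), whereas c
-- fixes only 0.  Since 2h = 2(n-1) resp. 4(n-1), the theorem follows.

open import Defs
open import Data.Nat using (ℕ; zero; suc; _+_; _*_; _∸_; _≤_; _<_; z≤n; s≤s; _<?_; _%_; _≡ᵇ_)
import Data.Nat.Properties as ℕP
open import Data.Nat.DivMod using ([m+n]%n≡m%n)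
open import Data.Fin using (Fin; toℕ; fromℕ<) renaming (zero to fz; suc to fs)
import Data.Fin as F
import Data.Fin.Properties as FP
open import Data.Bool using (Bool; true; false; not; _xor_; if_then_else_)
open import Data.Bool.Properties
  using (xor-assoc; xor-same; xor-identityʳ; xor-comm; true-xor; not-involutive; not-distribʳ-xor)
open import Data.Vec using (lookup)
open import Data.Vec.Properties using (lookup∘tabulate; tabulate∘lookup; tabulate-cong)
open import Data.List using (List; []; _∷_; length; allFin; _++_; map)
open import Data.List.Properties using (length-++; length-map)
open import Data.List.Membership.Propositional using (_∈_)
open import Data.List.Membership.Propositional.Properties using (∈-allFin)
open import Data.List.Relation.Unary.Any using (here; there)
open import Data.List.Relation.Unary.All using (All; []; _∷_)
import Data.List.Relation.Unary.All.Properties as AllP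
open import Data.Integer using (ℤ; -_; 0ℤ; 1ℤ)
import Data.Integer as ℤ
open import Data.Integer.Properties using (neg-involutive)
open import Data.Product using (Σ; ∃-syntax; _×_; _,_; proj₁; proj₂)
open import Data.Sum using (_⊎_; inj₁; inj₂)
open import Data.Empty using (⊥; ⊥-elim)
open import Relation.Nullary using (yes; no; ¬_)
open import Relation.Nullary.Decidable using (⌊_⌋)
open import Relation.Binary.Definitions using (tri<; tri≈; tri>)
open import Relation.Binary.PropositionalEquality
open import Function using (_∘_)

private variable n : ℕ

-- Signed permutations as functions on signed letters

lookup-∙ : (u v : SP n) (i : Fin n) → lookup (u ∙ v) i ≡ apply u (lookup v i)
lookup-∙ u v i = lookup∘tabulate _ i

pair-≡ : {A B : Set} {a a' : A} {b b' : B} → a ≡ a' → b ≡ b' → (a , b) ≡ (a' , b')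
pair-≡ refl refl = refl

apply-∙ : (u v : SP n) (z : SLetter n) → apply (u ∙ v) z ≡ apply u (apply v z)
apply-∙ u v (j , s) rewrite lookup-∙ u v j =
  pair-≡ refl (xor-assoc (proj₂ (lookup u (proj₁ (lookup v j)))) (proj₂ (lookup v j)) s)

apply-pos : (w : SP n) (i : Fin n) → apply w (i , false) ≡ lookup w i
apply-pos w i = pair-≡ refl (xor-identityʳ _)

apply-at : (x : SP n) {j k : Fin n} {τ : Bool} (σ : Bool) →
  lookup x j ≡ (k , τ) → apply x (j , σ) ≡ (k , τ xor σ)
apply-at x σ e rewrite e = refl

sp-ext-pos : {u v : SP n} → (∀ k → apply u (k , false) ≡ apply v (k , false)) → u ≡ v
sp-ext-pos {u = u} {v} h =
  trans (sym (tabulate∘lookup u)) (trans (tabulate-cong same) (tabulate∘lookup v))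
  where
  same : ∀ i → lookup u i ≡ lookup v i
  same i = trans (sym (apply-pos u i)) (trans (h i) (apply-pos v i))

sp-ext : {u v : SP n} → (∀ z → apply u z ≡ apply v z) → u ≡ v
sp-ext h = sp-ext-pos (λ k → h (k , false))

apply-id : (z : SLetter n) → apply (idSP {n}) z ≡ z
apply-id (j , s) rewrite lookup∘tabulate (λ i → i , false) j = refl

∙-assoc : (u v w : SP n) → (u ∙ v) ∙ w ≡ u ∙ (v ∙ w)
∙-assoc u v w = sp-ext λ z →
  trans (apply-∙ (u ∙ v) w z) (trans (apply-∙ u v _)
    (trans (cong (apply u) (sym (apply-∙ v w z))) (sym (apply-∙ u (v ∙ w) z))))

∙-identityˡ : (u : SP n) → idSP ∙ u ≡ u
∙-identityˡ u = sp-ext λ z → trans (apply-∙ idSP u z) (apply-id _)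

∙-identityʳ : (u : SP n) → u ∙ idSP ≡ u
∙-identityʳ u = sp-ext λ z → trans (apply-∙ u idSP z) (cong (apply u) (apply-id z))

-- A vector in SP n need not be a signed permutation; `Invertible w` says that
-- its action on signed letters is a bijection (every element of W is one).
record Invertible {n : ℕ} (w : SP n) : Set where
  constructor invertible
  field
    w⁻¹ : SP n
    left-inverse : ∀ z → apply w⁻¹ (apply w z) ≡ z
    right-inverse : ∀ z → apply w (apply w⁻¹ z) ≡ z

invAt-found : (w : SP n) (j i : Fin n) (L : List (Fin n)) →
  proj₁ (lookup w i) ≡ j → (∀ i' → proj₁ (lookup w i') ≡ j → i' ≡ i) →
  i ∈ L → invAt w j L ≡ (i , proj₂ (lookup w i))
invAt-found w j i (i₀ ∷ L) e unique mem with proj₁ (lookup w i₀) F.≟ j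
... | yes p rewrite unique i₀ p = refl
... | no ¬p with mem
...   | here refl = ⊥-elim (¬p e)
...   | there m = invAt-found w j i L e unique m

xor-false : (a b : Bool) → a xor b ≡ false → a ≡ b
xor-false false false _ = refl
xor-false true true _ = refl

flipSign : Bool → SLetter n → SLetter n
flipSign s (k , σ) = (k , σ xor s)

apply-flip : (x : SP n) (j : Fin n) (s : Bool) →
  apply x (j , s) ≡ flipSign s (apply x (j , false))
apply-flip x j s = pair-≡ refl (cong (_xor s) (sym (xor-identityʳ (proj₂ (lookup x j)))))

module _ {w : SP n} (iw : Invertible w) where
  open Invertible iw

  index-injective : (i i' : Fin n) → proj₁ (lookup w i') ≡ proj₁ (lookup w i) → i' ≡ i
  index-injective i i' e =
    trans (sym (cong proj₁ (left-inverse (i' , false))))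
      (trans (cong (λ k → proj₁ (lookup w⁻¹ k)) e) (cong proj₁ (left-inverse (i , false))))

  private
    inv-pos : (j : Fin n) → apply (inv w) (j , false) ≡ apply w⁻¹ (j , false)
    inv-pos j =
      trans (cong (λ x → (proj₁ x , proj₂ x xor false)) (lookup∘tabulate (λ j → invAt w j (allFin n)) j))
        (trans (cong (λ x → (proj₁ x , proj₂ x xor false))
                 (invAt-found w j i₀ (allFin n) hit (λ i' e' → index-injective i₀ i' (trans e' (sym hit))) (∈-allFin i₀)))
          (pair-≡ refl (cong (_xor false) sign)))
      where
      i₀ = proj₁ (lookup w⁻¹ j)
      hit : proj₁ (lookup w i₀) ≡ j
      hit = cong proj₁ (right-inverse (j , false))
      sign : proj₂ (lookup w i₀) ≡ proj₂ (lookup w⁻¹ j)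
      sign = xor-false _ _ (trans (cong (proj₂ (lookup w i₀) xor_) (sym (xor-identityʳ _)))
                                  (cong proj₂ (right-inverse (j , false))))

    inv-agrees : (z : SLetter n) → apply (inv w) z ≡ apply w⁻¹ z
    inv-agrees (j , s) =
      trans (apply-flip (inv w) j s) (trans (cong (flipSign s) (inv-pos j)) (sym (apply-flip w⁻¹ j s)))

  inv-cancelˡ : (z : SLetter n) → apply (inv w) (apply w z) ≡ z
  inv-cancelˡ z = trans (inv-agrees _) (left-inverse z)

  inv-cancelʳ : (z : SLetter n) → apply w (apply (inv w) z) ≡ z
  inv-cancelʳ z = trans (cong (apply w) (inv-agrees z)) (right-inverse z)

  inv-invertible : Invertible (inv w)
  inv-invertible = invertible w inv-cancelʳ inv-cancelˡ

  inv-unique : (z z' : SLetter n) → apply w z' ≡ z → apply (inv w) z ≡ z'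
  inv-unique z z' e = trans (cong (apply (inv w)) (sym e)) (inv-cancelˡ z')

∙-invertible : {u v : SP n} → Invertible u → Invertible v → Invertible (u ∙ v)
∙-invertible {u = u} {v} (invertible u' ul ur) (invertible v' vl vr) = invertible (v' ∙ u')
  (λ z → trans (apply-∙ v' u' _) (trans (cong (λ y → apply v' (apply u' y)) (apply-∙ u v z))
          (trans (cong (apply v') (ul _)) (vl z))))
  (λ z → trans (apply-∙ u v _) (trans (cong (λ y → apply u (apply v y)) (apply-∙ v' u' z))
          (trans (cong (apply u) (vr _)) (ur z))))

id-invertible : Invertible (idSP {n})
id-invertible {n} = invertible idSP (λ z → trans (apply-id {n} _) (apply-id z))
                                    (λ z → trans (apply-id {n} _) (apply-id z))

inv-∙ : {u v : SP n} → Invertible u → Invertible v → (z : SLetter n) →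
  apply (inv (u ∙ v)) z ≡ apply (inv v) (apply (inv u) z)
inv-∙ {u = u} {v} iu iv z = inv-unique (∙-invertible iu iv) z _
  (trans (apply-∙ u v _) (trans (cong (apply u) (inv-cancelʳ iv (apply (inv u) z))) (inv-cancelʳ iu z)))

involution-inv : {x : SP n} → Invertible x → (∀ z → apply x (apply x z) ≡ z) → inv x ≡ x
involution-inv ix x² = sp-ext λ y → inv-unique ix y _ (x² y)

-- Reflections and T-words

module _ (a b : Fin n) (s : Bool) where
  private
    reflSP-lookup : (k : Fin n) → lookup (reflSP a b s) k ≡
      (if ⌊ k F.≟ a ⌋ then (b , s) else (if ⌊ k F.≟ b ⌋ then (a , s) else (k , false)))
    reflSP-lookup k = lookup∘tabulate _ k

  reflSP-a : lookup (reflSP a b s) a ≡ (b , s)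
  reflSP-a rewrite reflSP-lookup a with a F.≟ a
  ... | yes _ = refl
  ... | no ¬p = ⊥-elim (¬p refl)

  reflSP-b : ¬ a ≡ b → lookup (reflSP a b s) b ≡ (a , s)
  reflSP-b a≢b rewrite reflSP-lookup b with b F.≟ a
  ... | yes p = ⊥-elim (a≢b (sym p))
  ... | no _ with b F.≟ b
  ...   | yes _ = refl
  ...   | no ¬p = ⊥-elim (¬p refl)

  reflSP-other : (k : Fin n) → ¬ k ≡ a → ¬ k ≡ b → lookup (reflSP a b s) k ≡ (k , false)
  reflSP-other k k≢a k≢b rewrite reflSP-lookup k with k F.≟ a
  ... | yes p = ⊥-elim (k≢a p)
  ... | no _ with k F.≟ b
  ...   | yes p = ⊥-elim (k≢b p)
  ...   | no _ = refl

xor-cancelˡ : (s σ : Bool) → s xor (s xor σ) ≡ σ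
xor-cancelˡ s σ = trans (sym (xor-assoc s s σ)) (cong (_xor σ) (xor-same s))

reflSP-involutive : (a b : Fin n) (s : Bool) → ¬ a ≡ b → (z : SLetter n) →
  apply (reflSP a b s) (apply (reflSP a b s) z) ≡ z
reflSP-involutive a b s a≢b (j , σ) with j F.≟ a
... | yes refl = trans (cong (apply t) (apply-at t σ (reflSP-a a b s)))
                   (trans (apply-at t (s xor σ) (reflSP-b a b s a≢b)) (pair-≡ refl (xor-cancelˡ s σ)))
  where t = reflSP a b s
... | no j≢a with j F.≟ b
...   | yes refl = trans (cong (apply t) (apply-at t σ (reflSP-b a b s a≢b)))
                     (trans (apply-at t (s xor σ) (reflSP-a a b s)) (pair-≡ refl (xor-cancelˡ s σ)))
  where t = reflSP a b s
...   | no j≢b = trans (cong (apply t) (apply-at t σ (reflSP-other a b s j j≢a j≢b)))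
                   (apply-at t σ (reflSP-other a b s j j≢a j≢b))
  where t = reflSP a b s

IsRefl-invertible : {t : SP n} → IsRefl t → Invertible t
IsRefl-invertible (a , b , s , a<b , refl) =
  invertible (reflSP a b s) (reflSP-involutive a b s a≢b) (reflSP-involutive a b s a≢b)
  where a≢b = FP.<⇒≢ a<b

prod-invertible : {ts : List (SP n)} → All IsRefl ts → Invertible (prod ts)
prod-invertible [] = id-invertible
prod-invertible (p ∷ ps) = ∙-invertible (IsRefl-invertible p) (prod-invertible ps)

TWord-invertible : {w : SP n} {k : ℕ} → TWord w k → Invertible w
TWord-invertible (ts , ps , _ , refl) = prod-invertible ps

InW-invertible : {w : SP n} → InW w → Invertible w
InW-invertible (k , tw) = TWord-invertible tw

prod-++ : (xs ys : List (SP n)) → prod (xs ++ ys) ≡ prod xs ∙ prod ys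
prod-++ [] ys = sym (∙-identityˡ _)
prod-++ (x ∷ xs) ys = trans (cong (x ∙_) (prod-++ xs ys)) (sym (∙-assoc x (prod xs) (prod ys)))

TWord-∙ : {u v : SP n} {a b : ℕ} → TWord u a → TWord v b → TWord (u ∙ v) (a + b)
TWord-∙ (xs , ax , refl , refl) (ys , ay , refl , refl) =
  xs ++ ys , AllP.++⁺ ax ay , length-++ xs , prod-++ xs ys

TWord-refl : {t : SP n} → IsRefl t → TWord t 1
TWord-refl {t = t} p = t ∷ [] , p ∷ [] , refl , ∙-identityʳ t

conj : SP n → SP n → SP n
conj g x = g ∙ (x ∙ inv g)

apply-conj : (g x : SP n) (z : SLetter n) → apply (conj g x) z ≡ apply g (apply x (apply (inv g) z))
apply-conj g x z = trans (apply-∙ g (x ∙ inv g) z) (cong (apply g) (apply-∙ x (inv g) z))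

conj-invertible : {g x : SP n} → Invertible g → Invertible x → Invertible (conj g x)
conj-invertible ig ix = ∙-invertible ig (∙-invertible ix (inv-invertible ig))

reflection-between : (a b : Fin n) (s : Bool) → ¬ a ≡ b →
  Σ (SP n) λ R → IsRefl R × lookup R a ≡ (b , s) × lookup R b ≡ (a , s)
    × (∀ k → ¬ k ≡ a → ¬ k ≡ b → lookup R k ≡ (k , false))
reflection-between a b s a≢b with FP.<-cmp a b
... | tri< lt _ _ = reflSP a b s , (a , b , s , lt , refl) , reflSP-a a b s , reflSP-b a b s a≢b , reflSP-other a b s
... | tri≈ _ e _ = ⊥-elim (a≢b e)
... | tri> _ _ gt = reflSP b a s , (b , a , s , gt , refl) , reflSP-b b a s (λ e → a≢b (sym e)) , reflSP-a b a s ,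
                    λ k p q → reflSP-other b a s k q p

xor-swap : (σ s τ : Bool) → σ xor (s xor τ) ≡ τ xor (s xor σ)
xor-swap false false false = refl
xor-swap false false true = refl
xor-swap false true false = refl
xor-swap false true true = refl
xor-swap true false false = refl
xor-swap true false true = refl
xor-swap true true false = refl
xor-swap true true true = refl

-- T is closed under conjugation: g ((a, s·b)) g⁻¹ = ((g a, g (s·b))).
conj-IsRefl : {g : SP n} → Invertible g → {t : SP n} → IsRefl t → IsRefl (conj g t)
conj-IsRefl {n} {g} ig (a , b , s , a<b , refl) = subst IsRefl (sym conj≡R) R-refl
  where
  a' = proj₁ (lookup g a)
  b' = proj₁ (lookup g b)
  σ = proj₂ (lookup g a)
  τ = proj₂ (lookup g b)
  t = reflSP a b s
  a≢b = FP.<⇒≢ a<b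
  a'≢b' : ¬ a' ≡ b'
  a'≢b' e = a≢b (index-injective ig b a e)
  target = reflection-between a' b' (τ xor (s xor σ)) a'≢b'
  R = proj₁ target
  R-refl = proj₁ (proj₂ target)
  R-a = proj₁ (proj₂ (proj₂ target))
  R-b = proj₁ (proj₂ (proj₂ (proj₂ target)))
  R-other = proj₂ (proj₂ (proj₂ (proj₂ target)))
  inv-a' : apply (inv g) (a' , false) ≡ (a , σ)
  inv-a' = inv-unique ig _ _ (pair-≡ refl (xor-same σ))
  inv-b' : apply (inv g) (b' , false) ≡ (b , τ)
  inv-b' = inv-unique ig _ _ (pair-≡ refl (xor-same τ))
  on-pos : ∀ k → apply g (apply t (apply (inv g) (k , false))) ≡ lookup R k
  on-pos k with k F.≟ a'
  ... | yes refl = trans (cong (λ y → apply g (apply t y)) inv-a')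
                     (trans (cong (apply g) (apply-at t σ (reflSP-a a b s)))
                       (trans (apply-at g (s xor σ) refl) (sym R-a)))
  ... | no k≢a' with k F.≟ b'
  ...   | yes refl = trans (cong (λ y → apply g (apply t y)) inv-b')
                       (trans (cong (apply g) (apply-at t τ (reflSP-b a b s a≢b)))
                         (trans (apply-at g (s xor τ) refl) (trans (pair-≡ refl (xor-swap σ s τ)) (sym R-b))))
  ...   | no k≢b' = trans (cong (apply g) t-fixes-y) (trans (inv-cancelʳ ig (k , false)) (sym (R-other k k≢a' k≢b')))
    where
    y = apply (inv g) (k , false)
    gy : apply g y ≡ (k , false)
    gy = inv-cancelʳ ig (k , false)
    y≢a : ¬ proj₁ y ≡ a
    y≢a e = k≢a' (trans (sym (cong proj₁ gy)) (cong (λ j → proj₁ (lookup g j)) e))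
    y≢b : ¬ proj₁ y ≡ b
    y≢b e = k≢b' (trans (sym (cong proj₁ gy)) (cong (λ j → proj₁ (lookup g j)) e))
    t-fixes-y : apply t y ≡ y
    t-fixes-y = apply-at t (proj₂ y) (reflSP-other a b s (proj₁ y) y≢a y≢b)
  conj≡R : conj g t ≡ R
  conj≡R = sp-ext-pos λ k → trans (apply-conj g t (k , false)) (trans (on-pos k) (sym (apply-pos R k)))

conj-prod : {g : SP n} → Invertible g → (ts : List (SP n)) → prod (map (conj g) ts) ≡ conj g (prod ts)
conj-prod {g = g} ig [] = sp-ext λ z →
  trans (apply-id z) (sym (trans (apply-conj g idSP z) (trans (cong (apply g) (apply-id _)) (inv-cancelʳ ig z))))
conj-prod {g = g} ig (t ∷ ts) = sp-ext λ z → begin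
    apply (conj g t ∙ prod (map (conj g) ts)) z
  ≡⟨ apply-∙ (conj g t) (prod (map (conj g) ts)) z ⟩
    apply (conj g t) (apply (prod (map (conj g) ts)) z)
  ≡⟨ cong (λ w → apply (conj g t) (apply w z)) (conj-prod ig ts) ⟩
    apply (conj g t) (apply (conj g (prod ts)) z)
  ≡⟨ apply-conj g t _ ⟩
    apply g (apply t (apply (inv g) (apply (conj g (prod ts)) z)))
  ≡⟨ cong (λ y → apply g (apply t (apply (inv g) y))) (apply-conj g (prod ts) z) ⟩
    apply g (apply t (apply (inv g) (apply g (apply (prod ts) (apply (inv g) z)))))
  ≡⟨ cong (λ y → apply g (apply t y)) (inv-cancelˡ ig _) ⟩
    apply g (apply t (apply (prod ts) (apply (inv g) z)))
  ≡⟨ cong (apply g) (sym (apply-∙ t (prod ts) _)) ⟩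
    apply g (apply (t ∙ prod ts) (apply (inv g) z))
  ≡⟨ sym (apply-conj g (t ∙ prod ts) z) ⟩
    apply (conj g (t ∙ prod ts)) z ∎
  where open ≡-Reasoning

TWord-conj : {g x : SP n} {k : ℕ} → Invertible g → TWord x k → TWord (conj g x) k
TWord-conj {g = g} ig (ts , ps , refl , refl) =
  map (conj g) ts , all-conj ps , length-map (conj g) ts , conj-prod ig ts
  where
  all-conj : {ts : List (SP _)} → All IsRefl ts → All IsRefl (map (conj g) ts)
  all-conj [] = []
  all-conj (p ∷ ps) = conj-IsRefl ig p ∷ all-conj ps

-- Integer vectors and the lower bound for reflection length
--
-- A signed permutation w acts on ℤⁿ; v : Fin n → ℤ is fixed by w when the
-- value of v at w(z) equals its value at z for every signed letter z.  A
-- reflection ((a, s·b)) fixes v iff v b = s·v a, a single linear equation;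
-- so a product of k reflections fixes every solution of k such equations,
-- which has a nonzero solution as soon as k < n.

signed : Bool → ℤ → ℤ
signed false x = x
signed true x = - x

signed-xor : (a b : Bool) (x : ℤ) → signed a (signed b x) ≡ signed (a xor b) x
signed-xor false b x = refl
signed-xor true false x = refl
signed-xor true true x = neg-involutive x

signed-0 : (a : Bool) → signed a 0ℤ ≡ 0ℤ
signed-0 false = refl
signed-0 true = refl

self-negating : (x : ℤ) → - x ≡ x → x ≡ 0ℤ
self-negating (ℤ.+ zero) _ = refl

value : (Fin n → ℤ) → SLetter n → ℤ
value v (a , s) = signed s (v a)

Equation : ℕ → Set
Equation n = SLetter n × SLetter n

Solves : (Fin n → ℤ) → Equation n → Set
Solves v (x , y) = value v x ≡ value v y

Nonzero : (Fin n → ℤ) → Set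
Nonzero {n} v = ∃[ i ] (¬ v i ≡ 0ℤ)

-- An equation of the list linking coordinate 0 to another coordinate; it is
-- used to eliminate coordinate 0 from the remaining equations.
record Pivot {m : ℕ} (es : List (Equation (suc m))) : Set where
  constructor pivot
  field
    other : Fin m
    sign₀ sign₁ : Bool
    rest : List (Equation (suc m))
    rest-length : length es ≡ suc (length rest)
    restore : ∀ v → value v (fz , sign₀) ≡ value v (fs other , sign₁) →
              All (Solves v) rest → All (Solves v) es

data Unmixed {m : ℕ} : Equation (suc m) → Set where
  both-later : ∀ a s b t → Unmixed ((fs a , s) , (fs b , t))
  both-first : ∀ s t → Unmixed ((fz , s) , (fz , t))

pivot-∷ : ∀ {m} (e : Equation (suc m)) {es} → Pivot es → Pivot (e ∷ es)
pivot-∷ e (pivot i s₀ s₁ rest len restore) =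
  pivot i s₀ s₁ (e ∷ rest) (cong suc len) (λ v eq → λ { (p ∷ ps) → p ∷ restore v eq ps })

find-pivot : ∀ {m} (es : List (Equation (suc m))) → Pivot es ⊎ All Unmixed es
find-pivot [] = inj₂ []
find-pivot (((fz , s) , (fs b , t)) ∷ es) = inj₁ (pivot b s t es refl (λ v e ps → e ∷ ps))
find-pivot (((fs a , s) , (fz , t)) ∷ es) = inj₁ (pivot a t s es refl (λ v e ps → sym e ∷ ps))
find-pivot (((fz , s) , (fz , t)) ∷ es) with find-pivot es
... | inj₁ p = inj₁ (pivot-∷ _ p)
... | inj₂ k = inj₂ (both-first s t ∷ k)
find-pivot (((fs a , s) , (fs b , t)) ∷ es) with find-pivot es
... | inj₁ p = inj₁ (pivot-∷ _ p)
... | inj₂ k = inj₂ (both-later a s b t ∷ k)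

substLetter : ∀ {m} → Fin m → Bool → SLetter (suc m) → SLetter m
substLetter i σ (fz , s) = (i , s xor σ)
substLetter i σ (fs j , s) = (j , s)

substAll : ∀ {m} → Fin m → Bool → List (Equation (suc m)) → List (Equation m)
substAll i σ [] = []
substAll i σ ((x , y) ∷ es) = (substLetter i σ x , substLetter i σ y) ∷ substAll i σ es

substAll-length : ∀ {m} (i : Fin m) σ es → length (substAll i σ es) ≡ length es
substAll-length i σ [] = refl
substAll-length i σ (e ∷ es) = cong suc (substAll-length i σ es)

substExtend : ∀ {m} → Fin m → Bool → (Fin m → ℤ) → Fin (suc m) → ℤ
substExtend i σ v fz = signed σ (v i)
substExtend i σ v (fs j) = v j

substExtend-value : ∀ {m} (i : Fin m) σ v (x : SLetter (suc m)) →
  value (substExtend i σ v) x ≡ value v (substLetter i σ x)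
substExtend-value i σ v (fz , s) = signed-xor s σ (v i)
substExtend-value i σ v (fs j , s) = refl

substExtend-solves : ∀ {m} (i : Fin m) σ v es →
  All (Solves v) (substAll i σ es) → All (Solves (substExtend i σ v)) es
substExtend-solves i σ v [] [] = []
substExtend-solves i σ v ((x , y) ∷ es) (p ∷ ps) =
  trans (substExtend-value i σ v x) (trans p (sym (substExtend-value i σ v y))) ∷ substExtend-solves i σ v es ps

-- Without a pivot, drop coordinate 0: keep the equations between later
-- coordinates and set coordinate 0 to zero.
dropFirst : ∀ {m} (es : List (Equation (suc m))) → All Unmixed es → List (Equation m)
dropFirst [] [] = []
dropFirst (_ ∷ es) (both-later a s b t ∷ us) = ((a , s) , (b , t)) ∷ dropFirst es us
dropFirst (_ ∷ es) (both-first s t ∷ us) = dropFirst es us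

dropFirst-length : ∀ {m} (es : List (Equation (suc m))) us → length (dropFirst {m} es us) ≤ length es
dropFirst-length [] [] = z≤n
dropFirst-length (_ ∷ es) (both-later a s b t ∷ us) = s≤s (dropFirst-length es us)
dropFirst-length (_ ∷ es) (both-first s t ∷ us) = ℕP.m≤n⇒m≤1+n (dropFirst-length es us)

dropFirst-shrinks : ∀ {m} (es : List (Equation (suc m))) us →
  (suc (length (dropFirst {m} es us)) ≤ length es) ⊎ (∀ v → (∀ j → v (fs j) ≡ 0ℤ) → All (Solves v) es)
dropFirst-shrinks [] [] = inj₂ (λ _ _ → [])
dropFirst-shrinks (_ ∷ es) (both-later a s b t ∷ us) with dropFirst-shrinks es us
... | inj₁ p = inj₁ (s≤s p)
... | inj₂ f = inj₂ (λ v z → trans (cong (signed s) (z a)) (trans (signed-0 s)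
                      (sym (trans (cong (signed t) (z b)) (signed-0 t)))) ∷ f v z)
dropFirst-shrinks (_ ∷ es) (both-first s t ∷ us) = inj₁ (s≤s (dropFirst-length es us))

zeroExtend : ∀ {m} → (Fin m → ℤ) → Fin (suc m) → ℤ
zeroExtend v fz = 0ℤ
zeroExtend v (fs j) = v j

zeroExtend-solves : ∀ {m} (es : List (Equation (suc m))) us v →
  All (Solves v) (dropFirst es us) → All (Solves (zeroExtend v)) es
zeroExtend-solves [] [] v _ = []
zeroExtend-solves (_ ∷ es) (both-later a s b t ∷ us) v (p ∷ ps) = p ∷ zeroExtend-solves es us v ps
zeroExtend-solves (_ ∷ es) (both-first s t ∷ us) v ps =
  trans (signed-0 s) (sym (signed-0 t)) ∷ zeroExtend-solves es us v ps

unit₀ : ∀ {m} → Fin (suc m) → ℤ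
unit₀ fz = 1ℤ
unit₀ (fs j) = 0ℤ

nonzero-solution : ∀ m (es : List (Equation (suc m))) → length es ≤ m →
  Σ (Fin (suc m) → ℤ) λ v → Nonzero v × All (Solves v) es
nonzero-solution zero [] _ = (λ _ → 1ℤ) , (fz , λ ()) , []
nonzero-solution (suc m) es len with find-pivot es
... | inj₁ (pivot i s₀ s₁ rest l restore)
    with nonzero-solution m (substAll i (s₀ xor s₁) rest)
           (subst (_≤ m) (sym (substAll-length i (s₀ xor s₁) rest)) (ℕP.≤-pred (subst (_≤ suc m) l len)))
...   | v , (j , nz) , sols = substExtend i σ v , (fs j , nz) ,
          restore (substExtend i σ v) pivot-solved (substExtend-solves i σ v rest sols)
  where
  σ = s₀ xor s₁
  pivot-solved : value (substExtend i σ v) (fz , s₀) ≡ value (substExtend i σ v) (fs i , s₁)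
  pivot-solved = trans (signed-xor s₀ σ (v i)) (cong (λ b → signed b (v i)) (xor-cancelˡ s₀ s₁))
nonzero-solution (suc m) es len | inj₂ us with dropFirst-shrinks es us
... | inj₂ solved = unit₀ , (fz , λ ()) , solved unit₀ (λ _ → refl)
... | inj₁ p with nonzero-solution m (dropFirst es us) (ℕP.≤-pred (ℕP.≤-trans p len))
...   | v , (j , nz) , sols = zeroExtend v , (fs j , nz) , zeroExtend-solves es us v sols

Fixes : SP n → (Fin n → ℤ) → Set
Fixes w v = ∀ z → value v (apply w z) ≡ value v z

fixes-pos : {w : SP n} {v : Fin n → ℤ} → (∀ j → value v (lookup w j) ≡ v j) → Fixes w v
fixes-pos {w = w} {v} h (j , σ) =
  trans (cong (λ b → signed b (v (proj₁ (lookup w j)))) (xor-comm (proj₂ (lookup w j)) σ))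
    (trans (sym (signed-xor σ (proj₂ (lookup w j)) (v (proj₁ (lookup w j))))) (cong (signed σ) (h j)))

fixes-∙ : {u w : SP n} {v : Fin n → ℤ} → Fixes u v → Fixes w v → Fixes (u ∙ w) v
fixes-∙ {u = u} {w} {v} fu fw z = trans (cong (value v) (apply-∙ u w z)) (trans (fu _) (fw z))

reflSP-fixes : (a b : Fin n) (s : Bool) (v : Fin n → ℤ) → ¬ a ≡ b →
  v b ≡ signed s (v a) → Fixes (reflSP a b s) v
reflSP-fixes a b s v a≢b e = fixes-pos {w = reflSP a b s} {v = v} on-pos
  where
  on-pos : ∀ j → value v (lookup (reflSP a b s) j) ≡ v j
  on-pos j with j F.≟ a
  ... | yes refl = trans (cong (value v) (reflSP-a a b s)) (trans (cong (signed s) e)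
                     (trans (signed-xor s s _) (cong (λ q → signed q (v a)) (xor-same s))))
  ... | no j≢a with j F.≟ b
  ...   | yes refl = trans (cong (value v) (reflSP-b a b s a≢b)) (sym e)
  ...   | no j≢b = cong (value v) (reflSP-other a b s j j≢a j≢b)

equationsOf : (ts : List (SP n)) → All IsRefl ts → List (Equation n)
equationsOf [] [] = []
equationsOf (t ∷ ts) ((a , b , s , _) ∷ ps) = ((b , false) , (a , s)) ∷ equationsOf ts ps

equationsOf-length : (ts : List (SP n)) (ps : All IsRefl ts) → length (equationsOf ts ps) ≡ length ts
equationsOf-length [] [] = refl
equationsOf-length (t ∷ ts) (_ ∷ ps) = cong suc (equationsOf-length ts ps)

equationsOf-fixed : (ts : List (SP n)) (ps : All IsRefl ts) (v : Fin n → ℤ) →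
  All (Solves v) (equationsOf ts ps) → Fixes (prod ts) v
equationsOf-fixed [] [] v _ z = cong (value v) (apply-id z)
equationsOf-fixed (t ∷ ts) ((a , b , s , a<b , refl) ∷ ps) v (e ∷ es) =
  fixes-∙ {u = reflSP a b s} {w = prod ts} {v = v}
    (reflSP-fixes a b s v (FP.<⇒≢ a<b) e) (equationsOf-fixed ts ps v es)

short-product-fixes : ∀ m (ts : List (SP (suc m))) → All IsRefl ts → length ts ≤ m →
  Σ (Fin (suc m) → ℤ) λ v → Nonzero v × Fixes (prod ts) v
short-product-fixes m ts ps len
  with nonzero-solution m (equationsOf ts ps) (subst (_≤ m) (sym (equationsOf-length ts ps)) len)
... | v , nz , sols = v , nz , equationsOf-fixed ts ps v sols

-- The Coxeter element c = [1 … n-1][n]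

IsLetter : SLetter n → ℕ → Bool → Set
IsLetter x i b = toℕ (proj₁ x) ≡ i × proj₂ x ≡ b

IsLetter-unique : {x y : SLetter n} {i : ℕ} {b : Bool} → IsLetter x i b → IsLetter y i b → x ≡ y
IsLetter-unique (e₁ , s₁) (e₂ , s₂) = pair-≡ (FP.toℕ-injective (trans e₁ (sym e₂))) (trans s₁ (sym s₂))

value-at : {v : Fin n → ℤ} {x : SLetter n} {j : Fin n} {b : Bool} →
  IsLetter x (toℕ j) b → value v x ≡ signed b (v j)
value-at {v = v} {x = k , s} (e , refl) = cong (λ q → signed s (v q)) (FP.toℕ-injective e)

private
  cAt-low : (k : Fin n) → suc (suc (toℕ k)) < n → IsLetter (cAt k) (suc (toℕ k)) false
  cAt-low {n} k p with suc (suc (toℕ k)) <? n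
  ... | yes q = FP.toℕ-fromℕ< _ , refl
  ... | no ¬q = ⊥-elim (¬q p)

  cAt-mid : (k : Fin n) → suc (suc (toℕ k)) ≡ n → IsLetter (cAt k) 0 true
  cAt-mid {n} k p with suc (suc (toℕ k)) <? n
  ... | yes q = ⊥-elim (ℕP.<-irrefl p q)
  ... | no ¬q with suc (toℕ k) ℕP.≟ n
  ...   | yes e = ⊥-elim (ℕP.1+n≢n (trans p (sym e)))
  ...   | no _ = first-is-0 k , refl
    where
    first-is-0 : ∀ {m} (k : Fin m) → toℕ (firstFin k) ≡ 0
    first-is-0 fz = refl
    first-is-0 (fs _) = refl

  cAt-top : (k : Fin n) → suc (toℕ k) ≡ n → IsLetter (cAt k) (toℕ k) true
  cAt-top {n} k p with suc (suc (toℕ k)) <? n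
  ... | yes q = ⊥-elim (ℕP.<-irrefl p (ℕP.<-trans (ℕP.n<1+n _) q))
  ... | no ¬q with suc (toℕ k) ℕP.≟ n
  ...   | yes e = refl , refl
  ...   | no ne = ⊥-elim (ne p)

  apply-c : (x : SLetter n) → apply (coxD n) x ≡ (proj₁ (cAt (proj₁ x)) , proj₂ (cAt (proj₁ x)) xor proj₂ x)
  apply-c (j , s) = cong (λ p → (proj₁ p , proj₂ p xor s)) (lookup∘tabulate cAt j)

  apply-c-letter : {x : SLetter n} {i j : ℕ} {b b' : Bool} → IsLetter x i b →
    IsLetter (cAt (proj₁ x)) j b' → IsLetter (apply (coxD n) x) j (b' xor b)
  apply-c-letter {x = x} (_ , s) (e' , s') =
    trans (cong (λ y → toℕ (proj₁ y)) (apply-c x)) e' , trans (cong proj₂ (apply-c x)) (cong₂ _xor_ s' s)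

-- The action of c: i ↦ i+1 (i ≤ n-2), n-1 ↦ -1, n ↦ -n (indices from 0 below).
c-low : {x : SLetter n} {i : ℕ} {b : Bool} → IsLetter x i b → suc (suc i) < n →
  IsLetter (apply (coxD n) x) (suc i) b
c-low {x = x} l@(refl , _) p = apply-c-letter l (cAt-low (proj₁ x) p)

c-mid : {x : SLetter n} {i : ℕ} {b : Bool} → IsLetter x i b → suc (suc i) ≡ n →
  IsLetter (apply (coxD n) x) 0 (not b)
c-mid {x = x} l@(refl , _) p = apply-c-letter l (cAt-mid (proj₁ x) p)

c-top : {x : SLetter n} {i : ℕ} {b : Bool} → IsLetter x i b → suc i ≡ n →
  IsLetter (apply (coxD n) x) i (not b)
c-top {x = x} l@(refl , _) p = apply-c-letter l (cAt-top (proj₁ x) p)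

-- c fixes no nonzero vector: a fixed vector is constant on the first n-1
-- coordinates (i ↦ i+1), while v₀ = -v_{n-2} and v_{n-1} = -v_{n-1}.
module _ {m : ℕ} {v : Fin (suc (suc m)) → ℤ} (fixed : Fixes (coxD (suc (suc m))) v) where
  private
    N = suc (suc m)

    c-relation : (k j : Fin N) {b : Bool} → IsLetter (apply (coxD N) (k , false)) (toℕ j) b →
      signed b (v j) ≡ v k
    c-relation k j l = trans (sym (value-at l)) (fixed (k , false))

    constant : ∀ i (k : Fin N) → toℕ k ≡ i → suc i < N → v k ≡ v fz
    constant zero k e _ = cong v (FP.toℕ-injective e)
    constant (suc i) k e lt =
      trans (c-relation k' k (subst (λ j → IsLetter _ j false) (sym e) (c-low (FP.toℕ-fromℕ< _ , refl) lt)))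
            (constant i k' (FP.toℕ-fromℕ< _) (ℕP.<-trans (ℕP.n<1+n _) lt))
      where
      k' : Fin N
      k' = fromℕ< (ℕP.<-trans (ℕP.n<1+n _) (ℕP.<-trans (ℕP.n<1+n _) lt))

    first-zero : v fz ≡ 0ℤ
    first-zero = self-negating _
      (trans (c-relation kₘ fz (c-mid (FP.toℕ-fromℕ< _ , refl) refl))
             (constant m kₘ (FP.toℕ-fromℕ< _) (ℕP.n<1+n _)))
      where
      kₘ : Fin N
      kₘ = fromℕ< (ℕP.<-trans (ℕP.n<1+n m) (ℕP.n<1+n (suc m)))

  c-fixes-only-zero : ∀ k → v k ≡ 0ℤ
  c-fixes-only-zero k with suc (toℕ k) ℕP.≟ N
  ... | yes top = self-negating _ (c-relation k k (c-top (refl , refl) top))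
  ... | no ¬top = trans (constant (toℕ k) k refl (ℕP.≤∧≢⇒< (FP.toℕ<n k) ¬top)) first-zero

-- ℓ(c) ≥ n: a shorter T-word for c would make c fix a nonzero vector.
c-length-lower-bound : ∀ m (ts : List (SP (suc (suc m)))) → All IsRefl ts →
  prod ts ≡ coxD (suc (suc m)) → suc (suc m) ≤ length ts
c-length-lower-bound m ts ps e with suc (suc m) ℕP.≤? length ts
... | yes p = p
... | no np with short-product-fixes (suc m) ts ps (ℕP.≤-pred (ℕP.≰⇒> np))
...   | v , (i , nz) , fixed = ⊥-elim (nz (c-fixes-only-zero (subst (λ w → Fixes w v) e fixed) i))

-- If u ∈ W has a T-word of length a and u⁻¹c one of length b with a + b = n,
-- then u ≤ c: by the lower bound ℓ(c) ≥ n all three words are minimal.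
NC-from-split : ∀ m {u : SP (suc (suc m))} {a b : ℕ} → Invertible u → TWord u a →
  TWord (inv u ∙ coxD (suc (suc m))) b → a + b ≡ suc (suc m) → InNC (coxD (suc (suc m))) u
NC-from-split m {u} {a} {b} iu wu@(A , pA , lA , eA) wr@(B , pB , lB , eB) a+b≡n =
  a , b , (wu , minimal-u) , (wr , minimal-rest) , (word-c , minimal-c)
  where
  c = coxD (suc (suc m))
  split : u ∙ (inv u ∙ c) ≡ c
  split = sp-ext λ z → trans (apply-∙ u (inv u ∙ c) z)
            (trans (cong (apply u) (apply-∙ (inv u) c z)) (inv-cancelʳ iu (apply c z)))
  word-c : TWord c (a + b)
  word-c = subst (λ w → TWord w (a + b)) split (TWord-∙ wu wr)
  minimal-c : ∀ ts → All IsRefl ts → prod ts ≡ c → a + b ≤ length ts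
  minimal-c ts ps e = subst (_≤ length ts) (sym a+b≡n) (c-length-lower-bound m ts ps e)
  minimal-u : ∀ ts → All IsRefl ts → prod ts ≡ u → a ≤ length ts
  minimal-u ts ps e = ℕP.+-cancelʳ-≤ b a (length ts)
    (subst (a + b ≤_) (trans (length-++ ts) (cong (length ts +_) lB))
      (minimal-c (ts ++ B) (AllP.++⁺ ps pB) (trans (prod-++ ts B) (trans (cong₂ _∙_ e eB) split))))
  minimal-rest : ∀ ts → All IsRefl ts → prod ts ≡ inv u ∙ c → b ≤ length ts
  minimal-rest ts ps e = ℕP.+-cancelˡ-≤ a b (length ts)
    (subst (a + b ≤_) (trans (length-++ A) (cong (_+ length ts) lA))
      (minimal-c (A ++ ts) (AllP.++⁺ pA ps) (trans (prod-++ A ts) (trans (cong₂ _∙_ eA e) split))))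

NC-invertible : {c w : SP n} → InNC c w → Invertible w
NC-invertible (a , b , (word , _) , _) = TWord-invertible word

-- The reflections t₀ = ((1 n)) and t₁ = c t₀ c⁻¹ lie in NC(W,c)

module _ (a b : Fin n) (s : Bool) (a≢b : ¬ a ≡ b) where
  private t = reflSP a b s

  reflSP-on-a : (x : SLetter n) {σ : Bool} → IsLetter x (toℕ a) σ → IsLetter (apply t x) (toℕ b) (s xor σ)
  reflSP-on-a (j , σ) (e , refl) with FP.toℕ-injective e
  ... | refl = cong (λ p → toℕ (proj₁ p)) (apply-at t σ (reflSP-a a b s)) , cong proj₂ (apply-at t σ (reflSP-a a b s))

  reflSP-on-b : (x : SLetter n) {σ : Bool} → IsLetter x (toℕ b) σ → IsLetter (apply t x) (toℕ a) (s xor σ)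
  reflSP-on-b (j , σ) (e , refl) with FP.toℕ-injective e
  ... | refl = cong (λ p → toℕ (proj₁ p)) (apply-at t σ (reflSP-b a b s a≢b)) ,
               cong proj₂ (apply-at t σ (reflSP-b a b s a≢b))

  reflSP-on-other : (x : SLetter n) → ¬ toℕ (proj₁ x) ≡ toℕ a → ¬ toℕ (proj₁ x) ≡ toℕ b → apply t x ≡ x
  reflSP-on-other (j , σ) x≢a x≢b =
    apply-at t σ (reflSP-other a b s j (λ e → x≢a (cong toℕ e)) (λ e → x≢b (cong toℕ e)))

module Reflections₀₁ (m : ℕ) where
  N = suc (suc m)
  c = coxD N

  letter : (j : ℕ) → j < N → Fin N
  letter j p = fromℕ< p

  toℕ-letter : ∀ j (p : j < N) → toℕ (letter j p) ≡ j
  toℕ-letter j p = FP.toℕ-fromℕ< p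

  module _ (i j : ℕ) (i<j : i < j) (j<N : j < N) (s : Bool) where
    private
      i<N = ℕP.<-trans i<j j<N
      distinct : ¬ letter i i<N ≡ letter j j<N
      distinct e = ℕP.<⇒≢ i<j (trans (sym (toℕ-letter i i<N)) (trans (cong toℕ e) (toℕ-letter j j<N)))

    refl-at : SP N
    refl-at = reflSP (letter i i<N) (letter j j<N) s

    refl-at-IsRefl : IsRefl refl-at
    refl-at-IsRefl = letter i i<N , letter j j<N , s ,
      subst₂ _<_ (sym (toℕ-letter i i<N)) (sym (toℕ-letter j j<N)) i<j , refl

    refl-at-on-i : (x : SLetter N) {σ : Bool} → IsLetter x i σ → IsLetter (apply refl-at x) j (s xor σ)
    refl-at-on-i x (e , σ≡) = subst (λ k → IsLetter (apply refl-at x) k _) (toℕ-letter j j<N)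
      (reflSP-on-a (letter i i<N) (letter j j<N) s distinct x (trans e (sym (toℕ-letter i i<N)) , σ≡))

    refl-at-on-j : (x : SLetter N) {σ : Bool} → IsLetter x j σ → IsLetter (apply refl-at x) i (s xor σ)
    refl-at-on-j x (e , σ≡) = subst (λ k → IsLetter (apply refl-at x) k _) (toℕ-letter i i<N)
      (reflSP-on-b (letter i i<N) (letter j j<N) s distinct x (trans e (sym (toℕ-letter j j<N)) , σ≡))

    refl-at-on-other : (x : SLetter N) → ¬ toℕ (proj₁ x) ≡ i → ¬ toℕ (proj₁ x) ≡ j → apply refl-at x ≡ x
    refl-at-on-other x x≢i x≢j = reflSP-on-other (letter i i<N) (letter j j<N) s distinct x
      (λ e → x≢i (trans e (toℕ-letter i i<N))) (λ e → x≢j (trans e (toℕ-letter j j<N)))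

  last-index : suc m < N
  last-index = ℕP.n<1+n _

  -- Y_i = ((i+1, i+2)) ((i+2, i+3)) ⋯ ((n-2, n-1)) ((n-1, -n)), as a
  -- signed permutation: fixes the letters below i, shifts i … n-2 up by one,
  -- and sends n-1 ↦ -n, n ↦ -i (0-based indices).
  record TailShape (i : ℕ) (w : SP N) : Set where
    field
      below : ∀ k → toℕ k < i → apply w (k , false) ≡ (k , false)
      shift : ∀ k → i ≤ toℕ k → suc (suc (toℕ k)) < N → IsLetter (apply w (k , false)) (suc (toℕ k)) false
      penultimate : ∀ k → suc (suc (toℕ k)) ≡ N → IsLetter (apply w (k , false)) (suc m) true
      last : ∀ k → suc (toℕ k) ≡ N → IsLetter (apply w (k , false)) i true

  tail-last : Σ (SP N) λ w → TailShape m w × TWord w 1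
  tail-last = t , shape , TWord-refl (refl-at-IsRefl m (suc m) (ℕP.n<1+n m) last-index true)
    where
    t = refl-at m (suc m) (ℕP.n<1+n m) last-index true
    shape : TailShape m t
    shape = record
      { below = λ k k<m → refl-at-on-other m (suc m) (ℕP.n<1+n m) last-index true (k , false)
                  (λ e → ℕP.<-irrefl e k<m) (λ e → ℕP.<-irrefl e (ℕP.<-trans k<m (ℕP.n<1+n m)))
      ; shift = λ k m≤k k<m → ⊥-elim (ℕP.<-irrefl refl (ℕP.≤-trans (s≤s m≤k) (ℕP.≤-pred (ℕP.≤-pred k<m))))
      ; penultimate = λ k k≡m → refl-at-on-i m (suc m) (ℕP.n<1+n m) last-index true (k , false)
                        (ℕP.suc-injective (ℕP.suc-injective k≡m) , refl)
      ; last = λ k k≡m+1 → refl-at-on-j m (suc m) (ℕP.n<1+n m) last-index true (k , false)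
                 (ℕP.suc-injective k≡m+1 , refl)
      }

  module _ (i : ℕ) (i<m : suc i ≤ m) where
    private
      i+1<N : suc i < N
      i+1<N = ℕP.<-trans (s≤s i<m) last-index

    adjacent : SP N
    adjacent = refl-at i (suc i) (ℕP.n<1+n i) i+1<N false

    adjacent-IsRefl : IsRefl adjacent
    adjacent-IsRefl = refl-at-IsRefl i (suc i) (ℕP.n<1+n i) i+1<N false

    tail-step : {w : SP N} → TailShape (suc i) w → TailShape i (adjacent ∙ w)
    tail-step {w} Y = record
      { below = λ k k<i → trans (apply-∙ s w (k , false)) (trans (cong (apply s) (below k (ℕP.<-trans k<i (ℕP.n<1+n i))))
                  (other (k , false) (λ e → ℕP.<-irrefl e k<i) (λ e → ℕP.<-irrefl e (ℕP.<-trans k<i (ℕP.n<1+n i)))))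
      ; shift = shift′
      ; penultimate = λ k k≡m → via-s (penultimate k k≡m) (λ e → ℕP.<-irrefl (sym e) (ℕP.<-trans (ℕP.n<1+n i) (s≤s i<m)))
                                  (λ e → ℕP.<-irrefl (sym e) (s≤s i<m))
      ; last = λ k k≡m+1 → subst (λ y → IsLetter y i true) (sym (apply-∙ s w (k , false)))
                 (refl-at-on-j i (suc i) (ℕP.n<1+n i) i+1<N false (apply w (k , false)) (last k k≡m+1))
      }
      where
      open TailShape Y
      s = adjacent
      other : (x : SLetter N) → ¬ toℕ (proj₁ x) ≡ i → ¬ toℕ (proj₁ x) ≡ suc i → apply s x ≡ x
      other = refl-at-on-other i (suc i) (ℕP.n<1+n i) i+1<N false
      via-s : ∀ {k j b} → IsLetter (apply w (k , false)) j b → ¬ j ≡ i → ¬ j ≡ suc i →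
        IsLetter (apply (s ∙ w) (k , false)) j b
      via-s {k} {j} {b} l@(e , _) j≢i j≢i+1 = subst (λ y → IsLetter y j b)
        (sym (trans (apply-∙ s w (k , false)) (other _ (λ e' → j≢i (trans (sym e) e')) (λ e' → j≢i+1 (trans (sym e) e'))))) l
      shift′ : ∀ k → i ≤ toℕ k → suc (suc (toℕ k)) < N → IsLetter (apply (s ∙ w) (k , false)) (suc (toℕ k)) false
      shift′ k i≤k k<m with toℕ k ℕP.≟ i
      ... | yes refl = subst (λ y → IsLetter y (suc i) false) (sym (trans (apply-∙ s w (k , false)) (cong (apply s) (below k (ℕP.n<1+n i)))))
                         (refl-at-on-i i (suc i) (ℕP.n<1+n i) i+1<N false (k , false) (refl , refl))
      ... | no k≢i = via-s (shift k (ℕP.≤∧≢⇒< i≤k (λ e → k≢i (sym e))) k<m)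
                       (λ e → ℕP.<-irrefl (sym e) (s≤s i≤k)) (λ e → k≢i (ℕP.suc-injective e))

  tail : ∀ d i → suc (i + d) ≡ suc m → Σ (SP N) λ w → TailShape i w × TWord w (suc d)
  tail zero i e rewrite ℕP.suc-injective (trans (cong suc (sym (ℕP.+-identityʳ i))) e) = tail-last
  tail (suc d) i e with tail d (suc i) (trans (cong suc (sym (ℕP.+-suc i d))) e)
  ... | w , shape , word = adjacent i i<m ∙ w , tail-step i i<m shape ,
                           TWord-∙ (TWord-refl (adjacent-IsRefl i i<m)) word
    where
    i<m : suc i ≤ m
    i<m = subst (suc i ≤_) (ℕP.suc-injective e) (subst (_≤ i + suc d) (ℕP.+-comm i 1) (ℕP.+-monoʳ-≤ i (s≤s z≤n)))

  Y : SP N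
  Y = proj₁ (tail m 0 refl)

  Y-shape : TailShape 0 Y
  Y-shape = proj₁ (proj₂ (tail m 0 refl))

  Y-word : TWord Y (suc m)
  Y-word = proj₂ (proj₂ (tail m 0 refl))

  0<m+1 : 0 < suc m
  0<m+1 = s≤s z≤n

  t₀ : SP N
  t₀ = refl-at 0 (suc m) 0<m+1 last-index false

  t₀-IsRefl : IsRefl t₀
  t₀-IsRefl = refl-at-IsRefl 0 (suc m) 0<m+1 last-index false

  t₀-invertible : Invertible t₀
  t₀-invertible = IsRefl-invertible t₀-IsRefl

  t₀-on-first : (x : SLetter N) {σ : Bool} → IsLetter x 0 σ → IsLetter (apply t₀ x) (suc m) σ
  t₀-on-first x = refl-at-on-i 0 (suc m) 0<m+1 last-index false x

  t₀-on-last : (x : SLetter N) {σ : Bool} → IsLetter x (suc m) σ → IsLetter (apply t₀ x) 0 σ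
  t₀-on-last x = refl-at-on-j 0 (suc m) 0<m+1 last-index false x

  t₀-on-other : (x : SLetter N) → ¬ toℕ (proj₁ x) ≡ 0 → ¬ toℕ (proj₁ x) ≡ suc m → apply t₀ x ≡ x
  t₀-on-other = refl-at-on-other 0 (suc m) 0<m+1 last-index false

  c-factorisation : c ≡ t₀ ∙ Y
  c-factorisation = sp-ext-pos λ k → trans (on-pos k) (sym (apply-∙ t₀ Y (k , false)))
    where
    open TailShape Y-shape
    on-pos : ∀ k → apply c (k , false) ≡ apply t₀ (apply Y (k , false))
    on-pos k with suc (suc (toℕ k)) ℕP.<? N
    ... | yes low = IsLetter-unique (c-low (refl , refl) low)
                      (subst (λ y → IsLetter y (suc (toℕ k)) false) (sym (t₀-on-other _ (λ e → ℕP.1+n≢0 (trans (sym (proj₁ l)) e))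
                          (λ e → ℕP.<-irrefl (trans (sym (proj₁ l)) e) (ℕP.≤-pred low)))) l)
      where l = shift k z≤n low
    ... | no ¬low with suc (toℕ k) ℕP.≟ N
    ...   | yes top = IsLetter-unique (c-top (refl , refl) top) (subst (λ j → IsLetter (apply t₀ (apply Y (k , false))) j true) (sym (ℕP.suc-injective top))
                        (t₀-on-first _ (last k top)))
    ...   | no ¬top = IsLetter-unique (c-mid (refl , refl) mid) (t₀-on-last _ (penultimate k mid))
      where
      mid : suc (suc (toℕ k)) ≡ N
      mid = ℕP.≤-antisym (ℕP.≤∧≢⇒< (FP.toℕ<n k) ¬top) (ℕP.≮⇒≥ ¬low)

  t₀⁻¹c≡Y : inv t₀ ∙ c ≡ Y
  t₀⁻¹c≡Y = sp-ext λ z → begin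
      apply (inv t₀ ∙ c) z              ≡⟨ apply-∙ (inv t₀) c z ⟩
      apply (inv t₀) (apply c z)        ≡⟨ cong (λ w → apply (inv t₀) (apply w z)) c-factorisation ⟩
      apply (inv t₀) (apply (t₀ ∙ Y) z) ≡⟨ cong (apply (inv t₀)) (apply-∙ t₀ Y z) ⟩
      apply (inv t₀) (apply t₀ (apply Y z)) ≡⟨ inv-cancelˡ t₀-invertible (apply Y z) ⟩
      apply Y z ∎
    where open ≡-Reasoning

  t₀∈NC : InNC c t₀
  t₀∈NC = NC-from-split m t₀-invertible (TWord-refl t₀-IsRefl)
            (subst (λ w → TWord w (suc m)) (sym t₀⁻¹c≡Y) Y-word) refl

  c-invertible : Invertible c
  c-invertible = subst Invertible (sym c-factorisation) (∙-invertible t₀-invertible (TWord-invertible Y-word))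

  t₁ : SP N
  t₁ = conj c t₀

  t₁-IsRefl : IsRefl t₁
  t₁-IsRefl = conj-IsRefl c-invertible t₀-IsRefl

  t₁-invertible : Invertible t₁
  t₁-invertible = IsRefl-invertible t₁-IsRefl

  -- t₁⁻¹ c = c (t₀⁻¹ c) c⁻¹, so it has a T-word of length n-1 as well.
  t₁⁻¹c≡conj : inv t₁ ∙ c ≡ conj c (inv t₀ ∙ c)
  t₁⁻¹c≡conj = sp-ext λ z → trans (apply-∙ (inv t₁) c z)
    (trans (inv-unique t₁-invertible (apply c z) (apply c (apply (inv t₀) z)) (t₁-image z))
      (sym (trans (apply-conj c (inv t₀ ∙ c) z) (trans (cong (apply c) (apply-∙ (inv t₀) c (apply (inv c) z)))
        (cong (λ y → apply c (apply (inv t₀) y)) (inv-cancelʳ c-invertible z))))))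
    where
    t₁-image : ∀ z → apply t₁ (apply c (apply (inv t₀) z)) ≡ apply c z
    t₁-image z = trans (apply-conj c t₀ (apply c (apply (inv t₀) z)))
                   (trans (cong (λ y → apply c (apply t₀ y)) (inv-cancelˡ c-invertible (apply (inv t₀) z)))
                   (cong (apply c) (inv-cancelʳ t₀-invertible z)))

  t₁∈NC : InNC c t₁
  t₁∈NC = NC-from-split m t₁-invertible (TWord-refl t₁-IsRefl)
            (subst (λ w → TWord w (suc m)) (sym (trans t₁⁻¹c≡conj (cong (conj c) t₀⁻¹c≡Y))) (TWord-conj c-invertible Y-word)) refl

-- Powers of c

par : ℕ → Bool
par zero = false
par (suc k) = not (par k)

module Powers (m : ℕ) where
  open Reflections₀₁ m

  cpow : ℕ → SP N
  cpow zero = idSP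
  cpow (suc j) = c ∙ cpow j

  cpow-invertible : ∀ j → Invertible (cpow j)
  cpow-invertible zero = id-invertible
  cpow-invertible (suc j) = ∙-invertible c-invertible (cpow-invertible j)

  cpow-+ : ∀ a b z → apply (cpow (a + b)) z ≡ apply (cpow a) (apply (cpow b) z)
  cpow-+ zero b z = sym (apply-id _)
  cpow-+ (suc a) b z = trans (apply-∙ c (cpow (a + b)) z)
    (trans (cong (apply c) (cpow-+ a b z)) (sym (apply-∙ c (cpow a) _)))

  cpow-suc : ∀ j z → apply (cpow (suc j)) z ≡ apply c (apply (cpow j) z)
  cpow-suc j z = apply-∙ c (cpow j) z

  cpow-commutes : ∀ j z → apply (cpow j) (apply c z) ≡ apply c (apply (cpow j) z)
  cpow-commutes j z = begin
    apply (cpow j) (apply c z)           ≡⟨ cong (apply (cpow j)) (sym (trans (cpow-suc 0 z) (cong (apply c) (apply-id z)))) ⟩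
    apply (cpow j) (apply (cpow 1) z)    ≡⟨ sym (cpow-+ j 1 z) ⟩
    apply (cpow (j + 1)) z               ≡⟨ cong (λ q → apply (cpow q) z) (ℕP.+-comm j 1) ⟩
    apply (cpow (suc j)) z               ≡⟨ cpow-suc j z ⟩
    apply c (apply (cpow j) z) ∎
    where open ≡-Reasoning

  cpow-low : ∀ d {x i b} → IsLetter x i b → i + d ≤ m → IsLetter (apply (cpow d) x) (i + d) b
  cpow-low zero {x} {i} {b} l p = subst₂ (λ y j → IsLetter y j b) (sym (apply-id x)) (sym (ℕP.+-identityʳ i)) l
  cpow-low (suc d) {x} {i} {b} l p = subst₂ (λ y j → IsLetter y j b) (sym (cpow-suc d x)) (sym (ℕP.+-suc i d))
    (c-low (cpow-low d l (ℕP.≤-trans (ℕP.n≤1+n _) i+d<m)) (s≤s (s≤s i+d<m)))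
    where
    i+d<m : suc (i + d) ≤ m
    i+d<m = subst (_≤ m) (ℕP.+-suc i d) p

  cpow-last : ∀ d {x b} → IsLetter x (suc m) b → IsLetter (apply (cpow d) x) (suc m) (b xor par d)
  cpow-last zero {x} {b} l = subst₂ (λ y q → IsLetter y (suc m) q) (sym (apply-id x)) (sym (xor-identityʳ b)) l
  cpow-last (suc d) {x} {b} l = subst₂ (λ y q → IsLetter y (suc m) q) (sym (cpow-suc d x)) (not-distribʳ-xor b (par d))
    (c-top (cpow-last d l) refl)

  cpow-n-1-low : ∀ {x i b} → IsLetter x i b → i ≤ m → IsLetter (apply (cpow (suc m)) x) i (not b)
  cpow-n-1-low {x} {i} {b} l i≤m =
    subst₂ (λ y j → IsLetter y j (not b)) (sym (trans (cong (λ q → apply (cpow q) x) split) (cpow-+ i (suc (m ∸ i)) x)))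
      (ℕP.+-identityˡ i)
      (cpow-low i (subst (λ y → IsLetter y 0 (not b)) (sym (cpow-suc (m ∸ i) x))
                     (c-mid reach-m (cong (λ q → suc (suc q)) (ℕP.m+[n∸m]≡n i≤m))))
                  (subst (_≤ m) (sym (ℕP.+-identityˡ i)) i≤m))
    where
    split : suc m ≡ i + suc (m ∸ i)
    split = trans (cong suc (sym (ℕP.m+[n∸m]≡n i≤m))) (sym (ℕP.+-suc i (m ∸ i)))
    reach-m : IsLetter (apply (cpow (m ∸ i)) x) (i + (m ∸ i)) b
    reach-m = cpow-low (m ∸ i) l (ℕP.≤-reflexive (ℕP.m+[n∸m]≡n i≤m))

  -- h = n-1 for n even, h = 2(n-1) for n odd.
  period-1 : ℕ
  period-1 = if par (suc m) then m else m + suc m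

  period : ℕ
  period = suc period-1

  period-cases : (par (suc m) ≡ true × period ≡ suc m) ⊎ (par (suc m) ≡ false × period ≡ suc m + suc m)
  period-cases with par (suc m)
  ... | true = inj₁ (refl , refl)
  ... | false = inj₂ (refl , refl)

  index-split : (x : SLetter N) → (toℕ (proj₁ x) ≤ m) ⊎ (toℕ (proj₁ x) ≡ suc m)
  index-split x with toℕ (proj₁ x) ℕP.≟ suc m
  ... | yes e = inj₂ e
  ... | no ne = inj₁ (ℕP.≤-pred (ℕP.≤∧≢⇒< (ℕP.≤-pred (FP.toℕ<n (proj₁ x))) ne))

  cpow-period : ∀ x → apply (cpow period) x ≡ flipSign (par (suc m)) x
  cpow-period x with period-cases | index-split x
  ... | inj₁ (odd , h≡n-1) | inj₁ low = trans (cong (λ q → apply (cpow q) x) h≡n-1)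
    (IsLetter-unique (cpow-n-1-low (refl , refl) low)
                     (refl , trans (cong (proj₂ x xor_) odd) (trans (xor-comm (proj₂ x) true) (true-xor (proj₂ x)))))
  ... | inj₁ (odd , h≡n-1) | inj₂ top = trans (cong (λ q → apply (cpow q) x) h≡n-1)
    (IsLetter-unique (cpow-last (suc m) (top , refl)) (top , refl))
  ... | inj₂ (even , h≡2n-2) | inj₁ low = trans (cong (λ q → apply (cpow q) x) h≡2n-2) (trans (cpow-+ (suc m) (suc m) x)
    (IsLetter-unique (cpow-n-1-low (cpow-n-1-low (refl , refl) low) low)
                     (refl , trans (cong (proj₂ x xor_) even) (trans (xor-identityʳ _) (sym (not-involutive (proj₂ x)))))))
  ... | inj₂ (even , h≡2n-2) | inj₂ top = trans (cong (λ q → apply (cpow q) x) h≡2n-2) (trans (cpow-+ (suc m) (suc m) x)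
    (IsLetter-unique (cpow-last (suc m) (cpow-last (suc m) (top , refl)))
                     (top , trans (cong (proj₂ x xor_) even) (trans (sym (xor-identityʳ _)) (sym (cong (λ q → (proj₂ x xor q) xor q) even))))))

  cpow-period-central : ∀ w z → apply (cpow period) (apply w z) ≡ apply w (apply (cpow period) z)
  cpow-period-central w (j , σ) = trans (cpow-period (apply w (j , σ)))
    (sym (trans (cong (apply w) (cpow-period (j , σ))) (pair-≡ refl (sym (xor-assoc (proj₂ (lookup w j)) σ (par (suc m)))))))

  period≤2n-2 : period ≤ suc m + suc m
  period≤2n-2 with period-cases
  ... | inj₁ (_ , e) = subst (_≤ suc m + suc m) (sym e) (ℕP.m≤m+n (suc m) (suc m))
  ... | inj₂ (_ , e) = ℕP.≤-reflexive e

  z₀ : SLetter N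
  z₀ = (fz , false)

  IsLetter-index : {x : SLetter N} {i j : ℕ} {b b' : Bool} → IsLetter x i b → IsLetter x j b' → i ≡ j
  IsLetter-index (e₁ , _) (e₂ , _) = trans (sym e₁) e₂

  IsLetter-sign : {x : SLetter N} {i j : ℕ} {b b' : Bool} → IsLetter x i b → IsLetter x j b' → b ≡ b'
  IsLetter-sign (_ , s₁) (_ , s₂) = trans (sym s₁) s₂

  cpow-t₀-first : ∀ d → IsLetter (apply (cpow d) (apply t₀ z₀)) (suc m) (par d)
  cpow-t₀-first d = cpow-last d (t₀-on-first z₀ (refl , refl))

  cpow-first-wrapped : ∀ e → e ≤ m → IsLetter (apply (cpow (e + suc m)) z₀) e true
  cpow-first-wrapped e e≤m = subst (λ y → IsLetter y e true) (sym (cpow-+ e (suc m) z₀))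
    (cpow-low e (cpow-n-1-low {z₀} (refl , refl) z≤n) e≤m)

  -- t₀ commutes with no power c^d, 0 < d < h: compare the images of the
  -- letter 1 under c^d t₀ and t₀ c^d.
  private
    unwrapped : ∀ d → 0 < d → d ≤ m → ¬ (apply (cpow d) (apply t₀ z₀) ≡ apply t₀ (apply (cpow d) z₀))
    unwrapped d 0<d d≤m eq = ℕP.<-irrefl (sym (IsLetter-index (subst (λ y → IsLetter y (suc m) (par d)) eq (cpow-t₀-first d)) rhs)) (s≤s d≤m)
      where
      low = cpow-low d {z₀} (refl , refl) d≤m
      rhs : IsLetter (apply t₀ (apply (cpow d) z₀)) d false
      rhs = subst (λ y → IsLetter y d false)
        (sym (t₀-on-other _ (λ e → ℕP.<-irrefl (sym (trans (sym (proj₁ low)) e)) 0<d)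
                            (λ e → ℕP.<-irrefl (trans (sym (proj₁ low)) e) (s≤s d≤m)))) low

    wrapped : ∀ e → e + suc m < period →
      ¬ (apply (cpow (e + suc m)) (apply t₀ z₀) ≡ apply t₀ (apply (cpow (e + suc m)) z₀))
    wrapped zero lt eq with period-cases
    ... | inj₁ (_ , h≡n-1) = ℕP.<-irrefl (sym h≡n-1) lt
    ... | inj₂ (even , _) = case (trans (sym even) (IsLetter-sign (subst (λ y → IsLetter y (suc m) (par (suc m))) eq (cpow-t₀-first (suc m)))
                                                                  (t₀-on-first _ (cpow-first-wrapped 0 z≤n))))
      where
      case : false ≡ true → ⊥
      case ()
    wrapped (suc e) lt eq =
      ℕP.<-irrefl (sym (IsLetter-index (subst (λ y → IsLetter y (suc m) (par (suc e + suc m))) eq (cpow-t₀-first (suc e + suc m))) rhs)) (s≤s e<m)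
      where
      e<m : suc e ≤ m
      e<m = ℕP.≤-pred (ℕP.+-cancelʳ-≤ (suc m) (suc (suc e)) (suc m) (ℕP.≤-trans lt period≤2n-2))
      low = cpow-first-wrapped (suc e) e<m
      rhs : IsLetter (apply t₀ (apply (cpow (suc e + suc m)) z₀)) (suc e) true
      rhs = subst (λ y → IsLetter y (suc e) true)
        (sym (t₀-on-other _ (λ q → ℕP.1+n≢0 (trans (sym (proj₁ low)) q))
                            (λ q → ℕP.<-irrefl (trans (sym (proj₁ low)) q) (s≤s e<m)))) low

  t₀-cpow-noncommuting : ∀ d → 0 < d → d < period →
    ¬ (apply (cpow d) (apply t₀ z₀) ≡ apply t₀ (apply (cpow d) z₀))
  t₀-cpow-noncommuting d 0<d d<h with d ℕP.≤? m
  ... | yes d≤m = unwrapped d 0<d d≤m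
  ... | no d>m = subst (λ q → ¬ (apply (cpow q) (apply t₀ z₀) ≡ apply t₀ (apply (cpow q) z₀))) d≡e+n-1
                   (wrapped (d ∸ suc m) (subst (_< period) (sym d≡e+n-1) d<h))
    where
    d≡e+n-1 : d ∸ suc m + suc m ≡ d
    d≡e+n-1 = ℕP.m∸n+n≡m (ℕP.≰⇒> d>m)

-- The action of φ_l and φ_r

module Action (m : ℕ) (l r : SP (suc (suc m))) (l-invertible : Invertible l) (r-invertible : Invertible r)
              (l²≡1 : l ∙ l ≡ idSP) (r²≡1 : r ∙ r ≡ idSP) (lr≡c : l ∙ r ≡ coxD (suc (suc m))) where
  open Reflections₀₁ m
  open Powers m

  private
    Z = SLetter N

    involution : (x : SP N) → x ∙ x ≡ idSP → ∀ z → apply x (apply x z) ≡ z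
    involution x e z = trans (sym (apply-∙ x x z)) (trans (cong (λ w → apply w z) e) (apply-id z))

    l² : ∀ z → apply l (apply l z) ≡ z
    l² = involution l l²≡1

    r² : ∀ z → apply r (apply r z) ≡ z
    r² = involution r r²≡1

    cc : Z → Z
    cc = apply c

    ci : Z → Z
    ci = apply (inv c)

    c-ci : ∀ z → cc (ci z) ≡ z
    c-ci = inv-cancelʳ c-invertible

    ci-c : ∀ z → ci (cc z) ≡ z
    ci-c = inv-cancelˡ c-invertible

    pw : ℕ → Z → Z
    pw j = apply (cpow j)

    pw⁻ : ℕ → Z → Z
    pw⁻ j = apply (inv (cpow j))

  r≡lc : ∀ z → apply r z ≡ apply l (cc z)
  r≡lc z = trans (sym (l² (apply r z))) (cong (apply l) (trans (sym (apply-∙ l r z)) (cong (λ w → apply w z) lr≡c)))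

  lr : ∀ z → apply l (apply r z) ≡ cc z
  lr z = trans (cong (apply l) (r≡lc z)) (l² (cc z))

  lcl≡c⁻¹ : ∀ z → apply l (cc (apply l z)) ≡ ci z
  lcl≡c⁻¹ z = sym (inv-unique c-invertible z _ clcl)
    where
    clcl : cc (apply l (cc (apply l z))) ≡ z
    clcl = trans (sym (l² _)) (trans (cong (apply l) (trans (sym (r≡lc _))
             (trans (cong (apply r) (sym (r≡lc (apply l z)))) (r² (apply l z))))) (l² z))

  rl : ∀ z → apply r (apply l z) ≡ ci z
  rl z = trans (r≡lc (apply l z)) (lcl≡c⁻¹ z)

  lc≡c⁻¹l : ∀ z → apply l (cc z) ≡ ci (apply l z)
  lc≡c⁻¹l z = trans (sym (cong (λ y → apply l (cc y)) (l² z))) (lcl≡c⁻¹ (apply l z))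

  pw-suc : ∀ j z → pw (suc j) z ≡ cc (pw j z)
  pw-suc = cpow-suc

  pw⁻-suc : ∀ j z → pw⁻ (suc j) z ≡ pw⁻ j (ci z)
  pw⁻-suc j z = inv-∙ c-invertible (cpow-invertible j) z

  pw⁻-zero : ∀ z → pw⁻ 0 z ≡ z
  pw⁻-zero z = inv-unique id-invertible z z (apply-id z)

  pw⁻-ci : ∀ j z → pw⁻ j (ci z) ≡ ci (pw⁻ j z)
  pw⁻-ci j z = inv-unique (cpow-invertible j) (ci z) (ci (pw⁻ j z))
    (trans (sym (ci-c _)) (trans (cong ci (sym (cpow-commutes j (ci (pw⁻ j z)))))
      (trans (cong (λ y → ci (pw j y)) (c-ci (pw⁻ j z))) (cong ci (inv-cancelʳ (cpow-invertible j) z)))))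

  apply-φ : (x w : SP N) (z : Z) → apply (φ x w) z ≡ apply x (apply (inv w) (apply x z))
  apply-φ x w z = trans (apply-∙ x (inv w ∙ x) z) (cong (apply x) (apply-∙ (inv w) x z))

  opaque
    Rot : ℕ → SP N → SP N
    Rot j w = conj (cpow j) w

    Ref : ℕ → SP N → SP N
    Ref j w = l ∙ (Rot j (inv w) ∙ l)

    apply-Rot : ∀ j w z → apply (Rot j w) z ≡ pw j (apply w (pw⁻ j z))
    apply-Rot j w z = apply-conj (cpow j) w z

    apply-Ref : ∀ j w z → apply (Ref j w) z ≡ apply l (apply (Rot j (inv w)) (apply l z))
    apply-Ref j w z = trans (apply-∙ l (Rot j (inv w) ∙ l) z) (cong (apply l) (apply-∙ (Rot j (inv w)) l z))

    Rot-invertible : ∀ j {w} → Invertible w → Invertible (Rot j w)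
    Rot-invertible j iw = conj-invertible (cpow-invertible j) iw

    Ref-invertible : ∀ j {w} → Invertible w → Invertible (Ref j w)
    Ref-invertible j iw = ∙-invertible l-invertible (∙-invertible (Rot-invertible j (inv-invertible iw)) l-invertible)

  Rot-compose : ∀ j u v z → apply (Rot j u) (apply (Rot j v) z) ≡ pw j (apply u (apply v (pw⁻ j z)))
  Rot-compose j u v z = begin
    apply (Rot j u) (apply (Rot j v) z)               ≡⟨ apply-Rot j u _ ⟩
    pw j (apply u (pw⁻ j (apply (Rot j v) z)))        ≡⟨ cong (λ y → pw j (apply u (pw⁻ j y))) (apply-Rot j v z) ⟩
    pw j (apply u (pw⁻ j (pw j (apply v (pw⁻ j z))))) ≡⟨ cong (λ y → pw j (apply u y)) (inv-cancelˡ (cpow-invertible j) _) ⟩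
    pw j (apply u (apply v (pw⁻ j z))) ∎
    where open ≡-Reasoning

  Rot-cancelˡ : ∀ j {w} → Invertible w → ∀ z → apply (Rot j (inv w)) (apply (Rot j w) z) ≡ z
  Rot-cancelˡ j {w} iw z = trans (Rot-compose j (inv w) w z)
    (trans (cong (pw j) (inv-cancelˡ iw _)) (inv-cancelʳ (cpow-invertible j) z))

  inv-Rot : ∀ j {w} → Invertible w → ∀ z → apply (inv (Rot j w)) z ≡ apply (Rot j (inv w)) z
  inv-Rot j {w} iw z = inv-unique (Rot-invertible j iw) z _
    (trans (Rot-compose j w (inv w) z) (trans (cong (pw j) (inv-cancelʳ iw _)) (inv-cancelʳ (cpow-invertible j) z)))

  inv-Ref : ∀ j {w} → Invertible w → ∀ z → apply (inv (Ref j w)) z ≡ apply l (apply (Rot j w) (apply l z))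
  inv-Ref j {w} iw z = inv-unique (Ref-invertible j iw) z _
    (trans (apply-Ref j w _) (trans (cong (λ q → apply l (apply (Rot j (inv w)) q)) (l² _))
      (trans (cong (apply l) (Rot-cancelˡ j iw (apply l z))) (l² z))))

  Rot-zero : ∀ w z → apply (Rot 0 w) z ≡ apply w z
  Rot-zero w z = trans (apply-Rot 0 w z) (trans (apply-id _) (cong (apply w) (pw⁻-zero z)))

  -- c^h is central, so Rot h = Rot 0 and hence Ref h = Ref 0.
  Rot-period : ∀ w z → apply (Rot period w) z ≡ apply w z
  Rot-period w z = trans (apply-Rot period w z)
    (trans (cpow-period-central w (pw⁻ period z)) (cong (apply w) (inv-cancelʳ (cpow-invertible period) z)))

  Ref-period : ∀ w → Ref period w ≡ Ref 0 w
  Ref-period w = sp-ext λ z → trans (apply-Ref period w z)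
    (trans (cong (apply l) (trans (Rot-period (inv w) (apply l z)) (sym (Rot-zero (inv w) (apply l z)))))
      (sym (apply-Ref 0 w z)))

  φl-Rot : ∀ j {w} → Invertible w → φ l (Rot j w) ≡ Ref j w
  φl-Rot j {w} iw = sp-ext λ z → trans (apply-φ l (Rot j w) z)
    (trans (cong (apply l) (inv-Rot j iw (apply l z))) (sym (apply-Ref j w z)))

  φl-Ref : ∀ j {w} → Invertible w → φ l (Ref j w) ≡ Rot j w
  φl-Ref j {w} iw = sp-ext λ z → trans (apply-φ l (Ref j w) z)
    (trans (cong (apply l) (inv-Ref j iw (apply l z)))
      (trans (l² (apply (Rot j w) (apply l (apply l z)))) (cong (apply (Rot j w)) (l² z))))

  φr-Rot : ∀ j {w} → Invertible w → φ r (Rot j w) ≡ Ref (suc j) w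
  φr-Rot j {w} iw = sp-ext λ z → begin
      apply (φ r (Rot j w)) z
    ≡⟨ apply-φ r (Rot j w) z ⟩
      apply r (apply (inv (Rot j w)) (apply r z))
    ≡⟨ cong (apply r) (inv-Rot j iw (apply r z)) ⟩
      apply r (apply (Rot j (inv w)) (apply r z))
    ≡⟨ r≡lc _ ⟩
      apply l (cc (apply (Rot j (inv w)) (apply r z)))
    ≡⟨ cong (λ y → apply l (cc (apply (Rot j (inv w)) y))) (r≡lc z) ⟩
      apply l (cc (apply (Rot j (inv w)) (apply l (cc z))))
    ≡⟨ cong (λ y → apply l (cc y)) (apply-Rot j (inv w) (apply l (cc z))) ⟩
      apply l (cc (pw j (apply (inv w) (pw⁻ j (apply l (cc z))))))
    ≡⟨ cong (λ y → apply l (cc (pw j (apply (inv w) (pw⁻ j y))))) (lc≡c⁻¹l z) ⟩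
      apply l (cc (pw j (apply (inv w) (pw⁻ j (ci (apply l z))))))
    ≡⟨ cong (λ y → apply l (cc (pw j (apply (inv w) y)))) (sym (pw⁻-suc j (apply l z))) ⟩
      apply l (cc (pw j (apply (inv w) (pw⁻ (suc j) (apply l z)))))
    ≡⟨ cong (apply l) (sym (pw-suc j _)) ⟩
      apply l (pw (suc j) (apply (inv w) (pw⁻ (suc j) (apply l z))))
    ≡⟨ cong (apply l) (sym (apply-Rot (suc j) (inv w) (apply l z))) ⟩
      apply l (apply (Rot (suc j) (inv w)) (apply l z))
    ≡⟨ sym (apply-Ref (suc j) w z) ⟩
      apply (Ref (suc j) w) z ∎
    where open ≡-Reasoning

  -- φ_r (Ref k w) = c⁻¹ (c^k w c^-k) c = c^(k-1) w c^-(k-1) for k ≥ 1 (and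
  -- c^(h-1) w c^-(h-1) for k = 0, since c^h is central).
  φr-Ref-shape : ∀ k {w} → Invertible w → ∀ z → apply (φ r (Ref k w)) z ≡ ci (apply (Rot k w) (cc z))
  φr-Ref-shape k {w} iw z = begin
      apply (φ r (Ref k w)) z
    ≡⟨ apply-φ r (Ref k w) z ⟩
      apply r (apply (inv (Ref k w)) (apply r z))
    ≡⟨ cong (apply r) (inv-Ref k iw (apply r z)) ⟩
      apply r (apply l (apply (Rot k w) (apply l (apply r z))))
    ≡⟨ rl _ ⟩
      ci (apply (Rot k w) (apply l (apply r z)))
    ≡⟨ cong (λ y → ci (apply (Rot k w) y)) (lr z) ⟩
      ci (apply (Rot k w) (cc z)) ∎
    where open ≡-Reasoning

  φr-Ref : ∀ j {w} → Invertible w → φ r (Ref (suc j) w) ≡ Rot j w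
  φr-Ref j {w} iw = sp-ext λ z → begin
      apply (φ r (Ref (suc j) w)) z
    ≡⟨ φr-Ref-shape (suc j) iw z ⟩
      ci (apply (Rot (suc j) w) (cc z))
    ≡⟨ cong ci (apply-Rot (suc j) w (cc z)) ⟩
      ci (pw (suc j) (apply w (pw⁻ (suc j) (cc z))))
    ≡⟨ cong ci (pw-suc j _) ⟩
      ci (cc (pw j (apply w (pw⁻ (suc j) (cc z)))))
    ≡⟨ ci-c _ ⟩
      pw j (apply w (pw⁻ (suc j) (cc z)))
    ≡⟨ cong (λ y → pw j (apply w y)) (trans (pw⁻-suc j (cc z)) (cong (pw⁻ j) (ci-c z))) ⟩
      pw j (apply w (pw⁻ j z))
    ≡⟨ sym (apply-Rot j w z) ⟩
      apply (Rot j w) z ∎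
    where open ≡-Reasoning

  φr-Ref-zero : ∀ {w} → Invertible w → φ r (Ref 0 w) ≡ Rot period-1 w
  φr-Ref-zero {w} iw = sp-ext λ z → begin
      apply (φ r (Ref 0 w)) z
    ≡⟨ φr-Ref-shape 0 iw z ⟩
      ci (apply (Rot 0 w) (cc z))
    ≡⟨ cong ci (Rot-zero w (cc z)) ⟩
      ci (apply w (cc z))
    ≡⟨ cong (λ y → ci (apply w y)) (sym (trans (pw-suc k (pw⁻ k z)) (cong cc (inv-cancelʳ (cpow-invertible k) z)))) ⟩
      ci (apply w (pw period (pw⁻ k z)))
    ≡⟨ cong ci (sym (cpow-period-central w (pw⁻ k z))) ⟩
      ci (pw period (apply w (pw⁻ k z)))
    ≡⟨ cong ci (pw-suc k _) ⟩
      ci (cc (pw k (apply w (pw⁻ k z))))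
    ≡⟨ ci-c _ ⟩
      pw k (apply w (pw⁻ k z))
    ≡⟨ sym (apply-Rot k w z) ⟩
      apply (Rot k w) z ∎
    where
    open ≡-Reasoning
    k = period-1

  Form : Bool → ℕ → SP N → SP N
  Form false j = Rot j
  Form true j = Ref j

  NormalForm : List Bool → Set
  NormalForm u = Σ Bool λ b → Σ ℕ λ j → j < period × (∀ w → Invertible w → evalWord l r u w ≡ Form b j w)

  private
    then-φ : ∀ x u b j (F : SP N → SP N) → (∀ {w} → Invertible w → φ x (Form b j w) ≡ F w) →
      (∀ w → Invertible w → evalWord l r u w ≡ Form b j w) → ∀ w → Invertible w → φ x (evalWord l r u w) ≡ F w
    then-φ x u b j F step h w iw = trans (cong (φ x) {x = evalWord l r u w} {y = Form b j w} (h w iw)) (step iw)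

  normal-form-l : ∀ u → NormalForm u → NormalForm (true ∷ u)
  normal-form-l u (false , j , j<h , h) = true , j , j<h , then-φ l u false j (Ref j) (φl-Rot j) h
  normal-form-l u (true , j , j<h , h) = false , j , j<h , then-φ l u true j (Rot j) (φl-Ref j) h

  normal-form-r : ∀ u → NormalForm u → NormalForm (false ∷ u)
  normal-form-r u (false , j , j<h , h) with suc j ℕP.<? period
  ... | yes j+1<h = true , suc j , j+1<h , then-φ r u false j (Ref (suc j)) (φr-Rot j) h
  ... | no ¬j+1<h = true , 0 , s≤s z≤n , then-φ r u false j (Ref 0) wrap h
    where
    wrap : ∀ {w} → Invertible w → φ r (Rot j w) ≡ Ref 0 w
    wrap {w} iw = trans (φr-Rot j iw) (trans (cong (λ q → Ref q w) (ℕP.≤-antisym j<h (ℕP.≮⇒≥ ¬j+1<h))) (Ref-period w))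
  normal-form-r u (true , suc j , j<h , h) = false , j , ℕP.<-trans (ℕP.n<1+n j) j<h , then-φ r u true (suc j) (Rot j) (φr-Ref j) h
  normal-form-r u (true , zero , _ , h) = false , period-1 , ℕP.n<1+n _ , then-φ r u true 0 (Rot period-1) φr-Ref-zero h

  normal-form : ∀ u → NormalForm u
  normal-form [] = false , 0 , s≤s z≤n , λ w _ → sym (sp-ext (Rot-zero w))
  normal-form (true ∷ u) = normal-form-l u (normal-form u)
  normal-form (false ∷ u) = normal-form-r u (normal-form u)

  rotWord : ℕ → List Bool
  rotWord zero = []
  rotWord (suc j) = true ∷ false ∷ rotWord j

  rotWord-Rot : ∀ j w → Invertible w → evalWord l r (rotWord j) w ≡ Rot j w
  rotWord-Rot zero w iw = sym (sp-ext (Rot-zero w))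
  rotWord-Rot (suc j) w iw = begin
    φ l (φ r (evalWord l r (rotWord j) w))
      ≡⟨ cong (λ q → φ l (φ r q)) {x = evalWord l r (rotWord j) w} {y = Rot j w} (rotWord-Rot j w iw) ⟩
    φ l (φ r (Rot j w))                    ≡⟨ cong (φ l) (φr-Rot j iw) ⟩
    φ l (Ref (suc j) w)                    ≡⟨ φl-Ref (suc j) iw ⟩
    Rot (suc j) w ∎
    where open ≡-Reasoning

  refWord-Ref : ∀ j w → Invertible w → evalWord l r (true ∷ rotWord j) w ≡ Ref j w
  refWord-Ref j w iw = trans (cong (φ l) {x = evalWord l r (rotWord j) w} {y = Rot j w} (rotWord-Rot j w iw)) (φl-Rot j iw)

  -- The 2h maps already differ on t₀ and t₁, both of which are involutions.

  private
    pointwise : {u v : SP N} → u ≡ v → ∀ y → apply u y ≡ apply v y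
    pointwise e y = cong (λ q → apply q y) e

  inv-t₀ : inv t₀ ≡ t₀
  inv-t₀ = involution-inv t₀-invertible (Invertible.left-inverse t₀-invertible)

  inv-t₁ : inv t₁ ≡ t₁
  inv-t₁ = involution-inv t₁-invertible t₁-involutive
    where
    t₁-involutive : ∀ y → apply t₁ (apply t₁ y) ≡ y
    t₁-involutive y = begin
      apply t₁ (apply t₁ y)               ≡⟨ apply-conj c t₀ (apply t₁ y) ⟩
      cc (apply t₀ (ci (apply t₁ y)))     ≡⟨ cong (λ q → cc (apply t₀ (ci q))) (apply-conj c t₀ y) ⟩
      cc (apply t₀ (ci (cc (apply t₀ (ci y))))) ≡⟨ cong (λ q → cc (apply t₀ q)) (ci-c (apply t₀ (ci y))) ⟩
      cc (apply t₀ (apply t₀ (ci y)))     ≡⟨ cong cc (Invertible.left-inverse t₀-invertible (ci y)) ⟩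
      cc (ci y)                           ≡⟨ c-ci y ⟩
      y ∎
      where open ≡-Reasoning

  Rot-equal⇒commutes : ∀ x j j' → j ≤ j' → Rot j x ≡ Rot j' x →
    ∀ u → apply x (pw (j' ∸ j) u) ≡ pw (j' ∸ j) (apply x u)
  Rot-equal⇒commutes x j j' j≤j' eq u = pw-injective (begin
      pw j (apply x (pw d u))                  ≡⟨ cong (λ q → pw j (apply x q)) (sym (inv-cancelˡ (cpow-invertible j) (pw d u))) ⟩
      pw j (apply x (pw⁻ j (pw j (pw d u))))   ≡⟨ sym (apply-Rot j x (pw j (pw d u))) ⟩
      apply (Rot j x) (pw j (pw d u))          ≡⟨ cong (apply (Rot j x)) (sym (pw-j' u)) ⟩
      apply (Rot j x) (pw j' u)                ≡⟨ pointwise eq (pw j' u) ⟩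
      apply (Rot j' x) (pw j' u)               ≡⟨ apply-Rot j' x (pw j' u) ⟩
      pw j' (apply x (pw⁻ j' (pw j' u)))       ≡⟨ cong (λ q → pw j' (apply x q)) (inv-cancelˡ (cpow-invertible j') u) ⟩
      pw j' (apply x u)                        ≡⟨ pw-j' (apply x u) ⟩
      pw j (pw d (apply x u)) ∎)
    where
    open ≡-Reasoning
    d = j' ∸ j
    pw-j' : ∀ u → pw j' u ≡ pw j (pw d u)
    pw-j' u = trans (cong (λ q → pw q u) (sym (ℕP.m+[n∸m]≡n j≤j'))) (cpow-+ j d u)
    pw-injective : ∀ {a b} → pw j a ≡ pw j b → a ≡ b
    pw-injective {a} {b} e = trans (sym (inv-cancelˡ (cpow-invertible j) a))
                               (trans (cong (pw⁻ j) e) (inv-cancelˡ (cpow-invertible j) b))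

  private
    Rot-t₀-increasing : ∀ j j' → j < j' → j' < period → Rot j t₀ ≡ Rot j' t₀ → ⊥
    Rot-t₀-increasing j j' j<j' j'<h eq = t₀-cpow-noncommuting (j' ∸ j) (ℕP.m<n⇒0<n∸m j<j')
      (ℕP.≤-<-trans (ℕP.m∸n≤m j' j) j'<h) (sym (Rot-equal⇒commutes t₀ j j' (ℕP.<⇒≤ j<j') eq z₀))

  Rot-t₀-injective : ∀ j j' → j < period → j' < period → Rot j t₀ ≡ Rot j' t₀ → j ≡ j'
  Rot-t₀-injective j j' j<h j'<h eq with ℕP.<-cmp j j'
  ... | tri≈ _ j≡j' _ = j≡j'
  ... | tri< j<j' _ _ = ⊥-elim (Rot-t₀-increasing j j' j<j' j'<h eq)
  ... | tri> _ _ j'<j = ⊥-elim (Rot-t₀-increasing j' j j'<j j<h (sym eq))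

  -- Ref j t₀ = l (Rot j t₀) l, so Ref j t₀ determines Rot j t₀.
  Ref-t₀-injective : ∀ j j' → j < period → j' < period → Ref j t₀ ≡ Ref j' t₀ → j ≡ j'
  Ref-t₀-injective j j' j<h j'<h eq = Rot-t₀-injective j j' j<h j'<h (sp-ext λ u → begin
      apply (Rot j t₀) u                               ≡⟨ sym (unconj j u) ⟩
      apply l (apply (Ref j t₀) (apply l u))           ≡⟨ cong (apply l) (pointwise eq (apply l u)) ⟩
      apply l (apply (Ref j' t₀) (apply l u))          ≡⟨ unconj j' u ⟩
      apply (Rot j' t₀) u ∎)
    where
    open ≡-Reasoning
    unconj : ∀ k u → apply l (apply (Ref k t₀) (apply l u)) ≡ apply (Rot k t₀) u
    unconj k u = trans (cong (apply l) (apply-Ref k t₀ (apply l u)))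
      (trans (l² _) (trans (cong (apply (Rot k (inv t₀))) (l² u)) (cong (λ q → apply (Rot k q) u) inv-t₀)))

  -- ρ = c^-A l c^B reverses c: ρ c = c⁻¹ ρ.  If Rot A x = Ref B x for an
  -- involution x, then x commutes with ρ.  Should this hold for both t₀ and
  -- t₁ = c t₀ c⁻¹, then t₀ commutes with c², which is impossible when h > 2.
  module _ (A B : ℕ) where
    ρ : Z → Z
    ρ v = pw⁻ A (apply l (pw B v))

    ρ⁻ : Z → Z
    ρ⁻ u = pw⁻ B (apply l (pw A u))

    ρ⁻-ρ : ∀ v → ρ⁻ (ρ v) ≡ v
    ρ⁻-ρ v = trans (cong (λ q → pw⁻ B (apply l q)) (inv-cancelʳ (cpow-invertible A) (apply l (pw B v))))
               (trans (cong (pw⁻ B) (l² (pw B v))) (inv-cancelˡ (cpow-invertible B) v))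

    ρ-ρ⁻ : ∀ u → ρ (ρ⁻ u) ≡ u
    ρ-ρ⁻ u = trans (cong (λ q → pw⁻ A (apply l q)) (inv-cancelʳ (cpow-invertible B) (apply l (pw A u))))
               (trans (cong (pw⁻ A) (l² (pw A u))) (inv-cancelˡ (cpow-invertible A) u))

    ρ-c : ∀ v → ρ (cc v) ≡ ci (ρ v)
    ρ-c v = trans (cong (λ q → pw⁻ A (apply l q)) (cpow-commutes B v))
              (trans (cong (pw⁻ A) (lc≡c⁻¹l (pw B v))) (pw⁻-ci A (apply l (pw B v))))

    ρ-ci : ∀ v → ρ (ci v) ≡ cc (ρ v)
    ρ-ci v = sym (trans (cong (λ q → cc (ρ q)) (sym (c-ci v)))
                   (trans (cong cc (ρ-c (ci v))) (c-ci (ρ (ci v)))))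

    Rot≡Ref⇒commutes : ∀ x → inv x ≡ x → Rot A x ≡ Ref B x → ∀ v → apply x (ρ v) ≡ ρ (apply x v)
    Rot≡Ref⇒commutes x inv-x eq v = trans (conjugated (ρ v)) (cong (λ q → ρ (apply x q)) (ρ⁻-ρ v))
      where
      at-pw : ∀ z → pw A (apply x (pw⁻ A z)) ≡ apply l (pw B (apply x (pw⁻ B (apply l z))))
      at-pw z = trans (sym (apply-Rot A x z)) (trans (pointwise eq z) (trans (apply-Ref B x z)
                  (trans (cong (apply l) (apply-Rot B (inv x) (apply l z)))
                    (cong (λ q → apply l (pw B (apply q (pw⁻ B (apply l z))))) inv-x))))
      conjugated : ∀ u → apply x u ≡ ρ (apply x (ρ⁻ u))
      conjugated u = trans (sym (inv-cancelˡ (cpow-invertible A) (apply x u)))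
        (cong (pw⁻ A) (trans (cong (λ q → pw A (apply x q)) (sym (inv-cancelˡ (cpow-invertible A) u))) (at-pw (pw A u))))

  private
    commutes-c² : ∀ A B → (∀ v → apply t₀ (ρ A B v) ≡ ρ A B (apply t₀ v)) →
      (∀ v → apply t₁ (ρ A B v) ≡ ρ A B (apply t₁ v)) → ∀ y → cc (cc (apply t₀ y)) ≡ apply t₀ (cc (cc y))
    commutes-c² A B t₀ρ t₁ρ y = trans (cong cc (trans (cong (λ p → cc (apply t₀ p)) (sym (ci-c y))) (swap (cc y)))) (c-ci _)
      where
      swap-ρ : ∀ v → cc (apply t₀ (ci (ρ A B v))) ≡ ci (apply t₀ (cc (ρ A B v)))
      swap-ρ v = begin
          cc (apply t₀ (ci (ρ A B v)))     ≡⟨ sym (apply-conj c t₀ (ρ A B v)) ⟩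
          apply t₁ (ρ A B v)               ≡⟨ t₁ρ v ⟩
          ρ A B (apply t₁ v)               ≡⟨ cong (ρ A B) (apply-conj c t₀ v) ⟩
          ρ A B (cc (apply t₀ (ci v)))     ≡⟨ ρ-c A B _ ⟩
          ci (ρ A B (apply t₀ (ci v)))     ≡⟨ cong ci (sym (t₀ρ (ci v))) ⟩
          ci (apply t₀ (ρ A B (ci v)))     ≡⟨ cong (λ q → ci (apply t₀ q)) (ρ-ci A B v) ⟩
          ci (apply t₀ (cc (ρ A B v))) ∎
        where open ≡-Reasoning
      swap : ∀ q → cc (apply t₀ (ci q)) ≡ ci (apply t₀ (cc q))
      swap q = subst (λ p → cc (apply t₀ (ci p)) ≡ ci (apply t₀ (cc p))) (ρ-ρ⁻ A B q) (swap-ρ (ρ⁻ A B q))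

    pw-two : ∀ y → pw 2 y ≡ cc (cc y)
    pw-two y = trans (pw-suc 1 y) (cong cc (trans (pw-suc 0 y) (cong cc (apply-id y))))

  Rot≢Ref : 2 < period → ∀ A B → Rot A t₀ ≡ Ref B t₀ → Rot A t₁ ≡ Ref B t₁ → ⊥
  Rot≢Ref 2<h A B eq₀ eq₁ = t₀-cpow-noncommuting 2 (s≤s z≤n) 2<h
    (trans (pw-two (apply t₀ z₀)) (trans (commutes-c² A B (Rot≡Ref⇒commutes A B t₀ inv-t₀ eq₀)
                                                         (Rot≡Ref⇒commutes A B t₁ inv-t₁ eq₁) z₀)
                                         (cong (apply t₀) (sym (pw-two z₀)))))

  formAt : Fin period ⊎ Fin period → SP N → SP N
  formAt (inj₁ j) = Rot (toℕ j)
  formAt (inj₂ j) = Ref (toℕ j)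

  word : Fin period ⊎ Fin period → List Bool
  word (inj₁ j) = rotWord (toℕ j)
  word (inj₂ j) = true ∷ rotWord (toℕ j)

  word-formAt : ∀ i w → Invertible w → evalWord l r (word i) w ≡ formAt i w
  word-formAt (inj₁ j) = rotWord-Rot (toℕ j)
  word-formAt (inj₂ j) = refWord-Ref (toℕ j)

  formAt-injective : 2 < period → ∀ i i' → (∀ w → InNC c w → formAt i w ≡ formAt i' w) → i ≡ i'
  formAt-injective _ (inj₁ j) (inj₁ j') H =
    cong inj₁ (FP.toℕ-injective (Rot-t₀-injective _ _ (FP.toℕ<n j) (FP.toℕ<n j') (H t₀ t₀∈NC)))
  formAt-injective _ (inj₂ j) (inj₂ j') H =
    cong inj₂ (FP.toℕ-injective (Ref-t₀-injective _ _ (FP.toℕ<n j) (FP.toℕ<n j') (H t₀ t₀∈NC)))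
  formAt-injective 2<h (inj₁ j) (inj₂ j') H = ⊥-elim (Rot≢Ref 2<h _ _ (H t₀ t₀∈NC) (H t₁ t₁∈NC))
  formAt-injective 2<h (inj₂ j) (inj₁ j') H = ⊥-elim (Rot≢Ref 2<h _ _ (sym (H t₀ t₀∈NC)) (sym (H t₁ t₁∈NC)))

  formAt-surjective : ∀ u → Σ (Fin period ⊎ Fin period) λ i → ∀ w → Invertible w → evalWord l r u w ≡ formAt i w
  formAt-surjective u with normal-form u
  ... | false , j , j<h , acts = inj₁ (fromℕ< j<h) , λ w iw → trans (acts w iw) (cong (λ q → Rot q w) (sym (FP.toℕ-fromℕ< j<h)))
  ... | true , j , j<h , acts = inj₂ (fromℕ< j<h) , λ w iw → trans (acts w iw) (cong (λ q → Ref q w) (sym (FP.toℕ-fromℕ< j<h)))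

  dihedral-order : 2 < period → DihedralOrder c l r (period + period)
  dihedral-order 2<h = word ∘ F.splitAt period , injective , surjective
    where
    on-NC : ∀ i w → InNC c w → evalWord l r (word i) w ≡ formAt i w
    on-NC i w w∈NC = word-formAt i w (NC-invertible w∈NC)
    injective : ∀ i i' → SameOnNC c l r (word (F.splitAt period i)) (word (F.splitAt period i')) → i ≡ i'
    injective i i' same = trans (sym (FP.join-splitAt period period i))
      (trans (cong (F.join period period) (formAt-injective 2<h (F.splitAt period i) (F.splitAt period i') λ w w∈NC →
        trans (sym (on-NC (F.splitAt period i) w w∈NC)) (trans (same w w∈NC) (on-NC (F.splitAt period i') w w∈NC))))
        (FP.join-splitAt period period i'))
    surjective : ∀ u → ∃[ i ] SameOnNC c l r u (word (F.splitAt period i))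
    surjective u with formAt-surjective u
    ... | i , acts = F.join period period i , λ w w∈NC →
      trans (acts w (NC-invertible w∈NC))
        (trans (sym (on-NC i w w∈NC)) (cong (λ k → evalWord l r (word k) w) (sym (FP.splitAt-join period period i))))

even-test : ∀ k → (k % 2 ≡ᵇ 0) ≡ not (par k)
even-test zero = refl
even-test (suc zero) = refl
even-test (suc (suc k)) = trans (cong (λ q → q % 2 ≡ᵇ 0) (ℕP.+-comm 2 k))
  (trans (cong (_≡ᵇ 0) ([m+n]%n≡m%n k 2)) (trans (even-test k) (cong not (sym (not-involutive (par k))))))

double : ∀ x → 2 * x ≡ x + x
double x = cong (x +_) (ℕP.+-identityʳ x)

expectedOrder≡2h : ∀ m → expectedOrder (suc (suc m)) ≡ Powers.period m + Powers.period m
expectedOrder≡2h m with Powers.period-cases m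
... | inj₁ (odd , h≡n-1) = begin
    (if (suc (suc m) % 2 ≡ᵇ 0) then 2 * suc m else 4 * suc m)   ≡⟨ cong (λ q → if q then 2 * suc m else 4 * suc m) n-even ⟩
    2 * suc m                                                   ≡⟨ double (suc m) ⟩
    suc m + suc m                                               ≡⟨ sym (cong₂ _+_ h≡n-1 h≡n-1) ⟩
    Powers.period m + Powers.period m ∎
  where
  open ≡-Reasoning
  n-even : (suc (suc m) % 2 ≡ᵇ 0) ≡ true
  n-even = trans (even-test (suc (suc m))) (trans (not-involutive (par (suc m))) odd)
... | inj₂ (even , h≡2n-2) = begin
    (if (suc (suc m) % 2 ≡ᵇ 0) then 2 * suc m else 4 * suc m)   ≡⟨ cong (λ q → if q then 2 * suc m else 4 * suc m) n-odd ⟩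
    4 * suc m                                                   ≡⟨ ℕP.*-distribʳ-+ (suc m) 2 2 ⟩
    2 * suc m + 2 * suc m                                       ≡⟨ cong₂ _+_ (double (suc m)) (double (suc m)) ⟩
    (suc m + suc m) + (suc m + suc m)                           ≡⟨ sym (cong₂ _+_ h≡2n-2 h≡2n-2) ⟩
    Powers.period m + Powers.period m ∎
  where
  open ≡-Reasoning
  n-odd : (suc (suc m) % 2 ≡ᵇ 0) ≡ false
  n-odd = trans (even-test (suc (suc m))) (trans (not-involutive (par (suc m))) even)

-- h > 2 for n ≥ 3: h = 2(n-1) ≥ 4, or h = n-1 with n-1 odd and ≥ 2, so ≥ 3.
2<period : ∀ k → 2 < Powers.period (suc k)
2<period k with Powers.period-cases (suc k)
2<period zero | inj₁ (() , _)
2<period (suc k) | inj₁ (_ , h≡n-1) = subst (2 <_) (sym h≡n-1) (s≤s (s≤s (s≤s z≤n)))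
2<period k | inj₂ (_ , h≡2n-2) =
  subst (2 <_) (sym h≡2n-2) (s≤s (s≤s (subst (1 ≤_) (sym (ℕP.+-suc k (suc k))) (s≤s z≤n))))

mainTheorem14 : (n : ℕ) → 3 ≤ n →
    (l r : SP n) → InW l → InW r →
    l ∙ l ≡ idSP → r ∙ r ≡ idSP → l ∙ r ≡ coxD n →
    DihedralOrder (coxD n) l r (expectedOrder n)
mainTheorem14 (suc (suc (suc k))) (s≤s (s≤s (s≤s _))) l r l∈W r∈W l²≡1 r²≡1 lr≡c =
  subst (DihedralOrder (coxD (suc (suc (suc k)))) l r) (sym (expectedOrder≡2h (suc k)))
    (Action.dihedral-order (suc k) l r (InW-invertible l∈W) (InW-invertible r∈W) l²≡1 r²≡1 lr≡c (2<period k))
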